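{- Let $(V,\mathcal{B})$ be a $(v,k,1)$-BIBD with well-distributed minimal sub-BIBDs with parameter $m$, whose minimal sub-BIBDs are $(v',k,1)$-BIBDs; let $\mathcal{D}$ be the collection of minimal sub-BIBDs (as point sets). Fix $D_{1},D_{2}\in\mathcal{D}$ with $|D_{1}\cap D_{2}|=1$ (assuming such exist). For a triple $(x_{1},x_{2},x_{3})$ let $N(x_{1},x_{2},x_{3})$ denote the number of $D\in\mathcal{D}\setminus\{D_{1},D_{2}\}$ with $|D\cap(D_{1}\setminus D_{2})|=x_{1}$, $|D\cap D_{1}\cap D_{2}|=x_{2}$, $|D\cap(D_{2}\setminus D_{1})|=x_{3}$, and set $a^{(1)}=N(k,0,k)$, $a^{(2)}=N(k-1,1,k-1)$, $a^{(3)}=N(k,0,1)$, $a^{(4)}=N(1,0,k)$, $a^{(5)}=N(k,0,0)$, $a^{(6)}=N(0,0,k)$, $a^{(7)}=N(k-1,1,0)$, $a^{(8)}=N(0,1,k-1)$, $a^{(9)}=N(1,0,1)$, $a^{(10)}=N(1,0,0)$, $a^{(11)}=N(0,0,1)$, $a^{(12)}=N(0,1,0)$, $a^{(13)}=N(0,0,0)$ (all depending on $D_{1},D_{2}$). Then: $$a^{(5)}=\frac{(m-1)(v'-1)(v'-k)}{k(k-1)}-a^{(1)}-a^{(3)},\qquad a^{(6)}=\frac{(m-1)(v'-1)(v'-k)}{k(k-1)}-a^{(1)}-a^{(4)},$$ $$a^{(7)}=a^{(8)}=\frac{(m-1)(v'-1)}{k-1}-a^{(2)},$$ $$a^{(9)}=m(v'-1)^{2}-k^{2}a^{(1)}-(k-1)^{2}a^{(2)}-ka^{(3)}-ka^{(4)},$$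 $$a^{(10)}=m\left(v-1-\frac{k(v'-1)^{2}}{k-1}\right)+\frac{(v'-1)(v'-k)}{k-1}+k^{2}a^{(1)}+(k-1)^{2}a^{(2)}+ka^{(3)}+(k-1)a^{(4)},$$ $$a^{(11)}=m\left(v-1-\frac{k(v'-1)^{2}}{k-1}\right)+\frac{(v'-1)(v'-k)}{k-1}+k^{2}a^{(1)}+(k-1)^{2}a^{(2)}+(k-1)a^{(3)}+ka^{(4)},$$ $$a^{(12)}=m\left(\frac{v-1}{v'-1}-2\frac{v'-1}{k-1}\right)+2\frac{v'-k}{k-1}+a^{(2)},$$ $$a^{(13)}=m\left(\frac{v(v-1)}{v'(v'-1)}+(v'-1)^{2}+\frac{v-1}{v'-1}-2v'\left(\frac{v-1}{v'-1}-\frac{v'-1}{k}\right)\right)-\frac{2(v'-1)(v'-k)}{k}-(k^{2}-1)a^{(1)}-(k-1)^{2}a^{(2)}-(k-1)a^{(3)}-(k-1)a^{(4)}.$$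
   Context: A $(v,k,\lambda)$-BIBD is a pair $(V,\mathcal{B})$ where $V$ is a finite set of $v$ points and $\mathcal{B}$ is a set (no repeated blocks) of $k$-subsets of $V$, $k>1$, such that every pair of distinct points lies in exactly $\lambda$ blocks; trivial cases are excluded. A sub-BIBD of a $(v,k,1)$-BIBD $(V,\mathcal{B})$ is a pair $(V',\mathcal{B}')$ with $V'\subseteq V$, $\mathcal{B}'\subseteq\{B\in\mathcal{B}:B\subseteq V'\}$, which is itself a $(v',k,1)$-BIBD. A sub-BIBD is minimal if $v'$ is minimal among all sub-BIBDs with $v'>k$. $(V,\mathcal{B})$ has well-distributed minimal sub-BIBDs if there are integers $l,m$ such that every point lies in exactly $l$ minimal sub-BIBDs and every block lies in exactly $m$ minimal sub-BIBDs. -}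

module Defs where

open import Data.Nat using (ℕ; _≤_; _<_)
open import Data.Fin using (Fin)
open import Data.Fin.Subset using (Subset; _∈_; _⊆_; ∣_∣; _∩_; _─_; ⊤)
open import Data.Fin.Subset.Properties using (_∈?_; _⊆?_)
open import Data.Bool.Properties using () renaming (_≟_ to _≟B_)
open import Data.Vec.Properties using (≡-dec)
open import Data.List using (List; length; filter)
open import Data.List.Membership.Propositional using () renaming (_∈_ to _∈L_)
open import Data.List.Relation.Unary.Unique.Propositional using (Unique)
open import Data.Product using (Σ; _×_)
open import Relation.Nullary using (¬_; Dec; yes; no)
open import Relation.Nullary.Decidable using (_×-dec_; ¬?)
open import Relation.Binary.PropositionalEquality using (_≡_; _≢_)
open import Data.Integer using (+_)
open import Data.Rational using (ℚ; _/_; _÷_; 0ℚ; ≢-nonZero)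
import Data.Rational.Properties as ℚP
import Data.Nat as ℕ

_≟S_ : ∀ {v} (A B : Subset v) → Dec (A ≡ B)
_≟S_ = ≡-dec _≟B_

pairCount : ∀ {v} → List (Subset v) → Fin v → Fin v → ℕ
pairCount Bs x y = length (filter (λ B → (x ∈? B) ×-dec (y ∈? B)) Bs)

-- (|P|, k, λ)-BIBD with point set P ⊆ Fin v and block list Bs.
-- Nontriviality convention: 2 ≤ k < |P|.
record IsDesign {v : ℕ} (k lam : ℕ) (P : Subset v) (Bs : List (Subset v)) : Set where
  field
    two≤k      : 2 ≤ k
    k<size     : k < ∣ P ∣
    noRepeats  : Unique Bs
    blockInP   : ∀ B → B ∈L Bs → B ⊆ P
    blockSize  : ∀ B → B ∈L Bs → ∣ B ∣ ≡ k
    balanced   : ∀ x y → x ∈ P → y ∈ P → x ≢ y → pairCount Bs x y ≡ lam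

IsBIBD : (v k lam : ℕ) → List (Subset v) → Set
IsBIBD v k lam Bs = IsDesign k lam (⊤ {v}) Bs

IsSubBIBD : ∀ {v} (k : ℕ) → List (Subset v) → Subset v → Set
IsSubBIBD k Bs V' = Σ (List (Subset _)) λ B' → (∀ B → B ∈L B' → B ∈L Bs) × IsDesign k 1 V' B'

IsMinimalSubBIBD : ∀ {v} (k : ℕ) → List (Subset v) → Subset v → Set
IsMinimalSubBIBD k Bs V' =
  IsSubBIBD k Bs V' × k < ∣ V' ∣ ×
  (∀ W → IsSubBIBD k Bs W → k < ∣ W ∣ → ∣ V' ∣ ≤ ∣ W ∣)

pointCount : ∀ {v} → List (Subset v) → Fin v → ℕ
pointCount 𝒟 x = length (filter (x ∈?_) 𝒟)

blockCount : ∀ {v} → List (Subset v) → Subset v → ℕ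
blockCount 𝒟 B = length (filter (B ⊆?_) 𝒟)

Ncount : ∀ {v} → List (Subset v) → Subset v → Subset v → ℕ → ℕ → ℕ → ℕ
Ncount 𝒟 D₁ D₂ x₁ x₂ x₃ = length (filter test 𝒟)
  where
  test : ∀ D → Dec _
  test D = (¬? (D ≟S D₁)) ×-dec (¬? (D ≟S D₂)) ×-dec
           (∣ D ∩ (D₁ ─ D₂) ∣ ℕ.≟ x₁) ×-dec (∣ D ∩ D₁ ∩ D₂ ∣ ℕ.≟ x₂) ×-dec
           (∣ D ∩ (D₂ ─ D₁) ∣ ℕ.≟ x₃)

ι : ℕ → ℚ
ι n = + n / 1

-- total division on ℚ (x ÷' 0 = 0); all divisors used below are nonzero
_÷'_ : ℚ → ℚ → ℚ
p ÷' q with q ℚP.≟ 0ℚ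
... | yes _ = 0ℚ
... | no q≢0 = _÷_ p q {{≢-nonZero q≢0}}
infixl 7 _÷'_

module Submission where

-- In a Steiner system, the point set of a sub-BIBD is closed (it contains
-- the block through any two of its points), and a closed set with more than k points is
-- a sub-BIBD.  Hence two distinct minimal sub-BIBDs meet in at most one point or in a
-- block, so every member D ≠ D₁, D₂ has one of thirteen patterns.  Double counting gives
-- linear relations between the thirteen counts (blocks of D₁ avoiding or containing p
-- against the members containing them, pairs of points across D₁ ∖ D₂ and D₂ ∖ D₁,
-- points of D₁ ∖ D₂, members through p, and all members), together with the usual
-- parameter relations r(k - 1) = v' - 1, b k(k - 1) = v'(v' - 1), l(v' - 1) = m(v - 1),
-- |𝒟| v'(v' - 1) = m v(v - 1).  The same counts for the swapped pair (D₂, D₁) supply the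
-- mirrored relations, and solving the resulting linear system over ℚ proves the claim.

module Sums where
  open import Data.Nat
  open import Data.Nat.Properties
  open import Data.Bool using (Bool; true; false)
  open import Data.Fin using (Fin; zero; suc)
  open import Data.List using (List; []; _∷_; filter; length; allFin; tabulate)
  open import Data.List.Membership.Propositional using (_∈_)
  open import Data.List.Membership.Propositional.Properties using (∈-allFin)
  open import Data.List.Relation.Unary.Any using (here; there)
  import Data.List.Relation.Unary.All as All
  open import Data.List.Relation.Unary.Unique.Propositional using (Unique)
  open import Data.List.Relation.Unary.Unique.Propositional.Properties using (allFin⁺)
  open import Data.List.Relation.Unary.AllPairs using (_∷_)
  open import Relation.Nullary
  open import Relation.Nullary.Decidable using (_×-dec_)
  open import Relation.Binary.PropositionalEquality
  open import Relation.Binary.Definitions using (DecidableEquality)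
  open import Data.Product using (∃; _,_; _×_)
  open import Data.Empty using (⊥-elim)
  open import Level using (Level)
  open import Algebra.Properties.CommutativeSemigroup +-commutativeSemigroup using (interchange)

  private variable
    a b p q : Level
    A : Set a
    B : Set b
    P : Set p
    Q : Set q

  indB : Bool → ℕ
  indB true = 1
  indB false = 0

  ind : Dec P → ℕ
  ind d = indB (does d)

  ind-yes : (d : Dec P) → P → ind d ≡ 1
  ind-yes (yes _) _ = refl
  ind-yes (no ¬x) x = ⊥-elim (¬x x)

  ind-no : (d : Dec P) → ¬ P → ind d ≡ 0
  ind-no (yes x) ¬x = ⊥-elim (¬x x)
  ind-no (no _) _ = refl

  ind-⇔ : (d : Dec P) (e : Dec Q) → (P → Q) → (Q → P) → ind d ≡ ind e
  ind-⇔ (yes x) e f g = sym (ind-yes e (f x))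
  ind-⇔ (no ¬x) e f g = sym (ind-no e (λ y → ¬x (g y)))

  ind-pos : (d : Dec P) → 0 < ind d → P
  ind-pos (yes x) _ = x

  ind-pos-* : (d : Dec P) (e : Dec Q) → 0 < ind d * ind e → P × Q
  ind-pos-* (yes x) (yes y) _ = x , y

  ind-idem : (d : Dec P) → ind d * ind d ≡ ind d
  ind-idem (yes _) = refl
  ind-idem (no _) = refl

  ind-× : (d : Dec P) (e : Dec Q) → ind (d ×-dec e) ≡ ind d * ind e
  ind-× (yes _) e = sym (+-identityʳ (ind e))
  ind-× (no _) e = refl

  ind-¬ : (d : Dec P) → ind d + ind (¬? d) ≡ 1
  ind-¬ (yes _) = refl
  ind-¬ (no _) = refl

  ΣL : List A → (A → ℕ) → ℕ
  ΣL [] f = 0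
  ΣL (x ∷ xs) f = f x + ΣL xs f

  ΣF : ∀ n → (Fin n → ℕ) → ℕ
  ΣF n = ΣL (allFin n)

  ΣL-cong : ∀ (xs : List A) {f g : A → ℕ} → (∀ x → x ∈ xs → f x ≡ g x) → ΣL xs f ≡ ΣL xs g
  ΣL-cong [] h = refl
  ΣL-cong (x ∷ xs) h = cong₂ _+_ (h x (here refl)) (ΣL-cong xs (λ y m → h y (there m)))

  ΣF-cong : ∀ n {f g : Fin n → ℕ} → (∀ x → f x ≡ g x) → ΣF n f ≡ ΣF n g
  ΣF-cong n h = ΣL-cong (allFin n) (λ x _ → h x)

  ΣL-zero : ∀ (xs : List A) → ΣL xs (λ _ → 0) ≡ 0
  ΣL-zero [] = refl
  ΣL-zero (_ ∷ xs) = ΣL-zero xs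

  ΣL-+ : ∀ (xs : List A) (f g : A → ℕ) → ΣL xs (λ x → f x + g x) ≡ ΣL xs f + ΣL xs g
  ΣL-+ [] f g = refl
  ΣL-+ (x ∷ xs) f g rewrite ΣL-+ xs f g = interchange (f x) (g x) (ΣL xs f) (ΣL xs g)

  ΣL-*ˡ : ∀ (xs : List A) (c : ℕ) (f : A → ℕ) → ΣL xs (λ x → c * f x) ≡ c * ΣL xs f
  ΣL-*ˡ [] c f = sym (*-zeroʳ c)
  ΣL-*ˡ (x ∷ xs) c f rewrite ΣL-*ˡ xs c f = sym (*-distribˡ-+ c (f x) (ΣL xs f))

  ΣL-*ʳ : ∀ (xs : List A) (c : ℕ) (f : A → ℕ) → ΣL xs (λ x → f x * c) ≡ ΣL xs f * c
  ΣL-*ʳ [] c f = refl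
  ΣL-*ʳ (x ∷ xs) c f rewrite ΣL-*ʳ xs c f = sym (*-distribʳ-+ c (f x) (ΣL xs f))

  ΣL-const : ∀ (xs : List A) (c : ℕ) → ΣL xs (λ _ → c) ≡ length xs * c
  ΣL-const [] c = refl
  ΣL-const (x ∷ xs) c = cong (c +_) (ΣL-const xs c)

  ΣL-swap : ∀ (xs : List A) (ys : List B) (f : A → B → ℕ) →
            ΣL xs (λ x → ΣL ys (f x)) ≡ ΣL ys (λ y → ΣL xs (λ x → f x y))
  ΣL-swap [] ys f = sym (ΣL-zero ys)
  ΣL-swap (x ∷ xs) ys f rewrite ΣL-swap xs ys f = sym (ΣL-+ ys (f x) (λ y → ΣL xs (λ x → f x y)))

  length-filter : ∀ {Pr : A → Set p} (P? : ∀ x → Dec (Pr x)) (xs : List A) →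
                  length (filter P? xs) ≡ ΣL xs (λ x → ind (P? x))
  length-filter P? [] = refl
  length-filter P? (x ∷ xs) with does (P? x)
  ... | true = cong suc (length-filter P? xs)
  ... | false = length-filter P? xs

  ΣL-filter : ∀ {Pr : A → Set p} (P? : ∀ x → Dec (Pr x)) (xs : List A) (f : A → ℕ) →
              ΣL (filter P? xs) f ≡ ΣL xs (λ x → ind (P? x) * f x)
  ΣL-filter P? [] f = refl
  ΣL-filter P? (x ∷ xs) f with does (P? x)
  ... | true = cong₂ _+_ (sym (+-identityʳ (f x))) (ΣL-filter P? xs f)
  ... | false = ΣL-filter P? xs f

  ΣL-pick : (_≟_ : DecidableEquality A) → ∀ {xs : List A} {y : A} (f : A → ℕ) → Unique xs → y ∈ xs →
            ΣL xs (λ x → ind (x ≟ y) * f x) ≡ f y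
  ΣL-pick _≟_ {x ∷ xs} f (x∉xs ∷ _) (here refl) = begin
    ind (x ≟ x) * f x + ΣL xs (λ z → ind (z ≟ x) * f z) ≡⟨ cong₂ _+_ (cong (_* f x) (ind-yes (x ≟ x) refl))
                                                              (ΣL-cong xs (λ z z∈ → cong (_* f z) (ind-no (z ≟ x) (λ e → All.lookup x∉xs z∈ (sym e))))) ⟩
    1 * f x + ΣL xs (λ _ → 0)                          ≡⟨ cong₂ _+_ (*-identityˡ (f x)) (ΣL-zero xs) ⟩
    f x + 0                                            ≡⟨ +-identityʳ (f x) ⟩
    f x                                                ∎
    where open ≡-Reasoning
  ΣL-pick _≟_ {x ∷ xs} {y} f (x∉xs ∷ u) (there y∈) =
    cong₂ _+_ (cong (_* f x) (ind-no (x ≟ y) (λ e → All.lookup x∉xs y∈ e))) (ΣL-pick _≟_ f u y∈)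

  ΣF-pick : ∀ n (y : Fin n) (f : Fin n → ℕ) → ΣF n (λ x → ind (x Data.Fin.≟ y) * f x) ≡ f y
  ΣF-pick n y f = ΣL-pick Data.Fin._≟_ f (allFin⁺ n) (∈-allFin y)

  ΣL-split : (_≟_ : DecidableEquality A) → ∀ {xs : List A} {y : A} (f : A → ℕ) → Unique xs → y ∈ xs →
             ΣL xs f ≡ f y + ΣL xs (λ x → ind (¬? (x ≟ y)) * f x)
  ΣL-split _≟_ {xs} {y} f u y∈ = begin
    ΣL xs f                                                              ≡⟨ ΣL-cong xs (λ x _ → partition x) ⟩
    ΣL xs (λ x → ind (x ≟ y) * f x + ind (¬? (x ≟ y)) * f x)              ≡⟨ ΣL-+ xs _ _ ⟩
    ΣL xs (λ x → ind (x ≟ y) * f x) + ΣL xs (λ x → ind (¬? (x ≟ y)) * f x) ≡⟨ cong (_+ ΣL xs (λ x → ind (¬? (x ≟ y)) * f x)) (ΣL-pick _≟_ f u y∈) ⟩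
    f y + ΣL xs (λ x → ind (¬? (x ≟ y)) * f x)                            ∎
    where
    open ≡-Reasoning
    partition : ∀ x → f x ≡ ind (x ≟ y) * f x + ind (¬? (x ≟ y)) * f x
    partition x = begin
      f x                                          ≡⟨ *-identityˡ (f x) ⟨
      1 * f x                                      ≡⟨ cong (_* f x) (ind-¬ (x ≟ y)) ⟨
      (ind (x ≟ y) + ind (¬? (x ≟ y))) * f x        ≡⟨ *-distribʳ-+ (f x) (ind (x ≟ y)) _ ⟩
      ind (x ≟ y) * f x + ind (¬? (x ≟ y)) * f x    ∎

  ΣF-split : ∀ n (y : Fin n) (f : Fin n → ℕ) → ΣF n f ≡ f y + ΣF n (λ x → ind (¬? (x Data.Fin.≟ y)) * f x)
  ΣF-split n y f = ΣL-split Data.Fin._≟_ f (allFin⁺ n) (∈-allFin y)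

  ΣL-pos : ∀ (xs : List A) (f : A → ℕ) → 0 < ΣL xs f → ∃ λ x → x ∈ xs × 0 < f x
  ΣL-pos (x ∷ xs) f h with f x in fx
  ... | suc _ = x , here refl , subst (0 <_) (sym fx) (s≤s z≤n)
  ... | zero with ΣL-pos xs f h
  ...   | y , y∈ , fy = y , there y∈ , fy

  ΣL-zero⁻ : ∀ (xs : List A) (f : A → ℕ) → ΣL xs f ≡ 0 → ∀ {x} → x ∈ xs → f x ≡ 0
  ΣL-zero⁻ (y ∷ xs) f h (here refl) = m+n≡0⇒m≡0 (f y) h
  ΣL-zero⁻ (y ∷ xs) f h (there x∈) = ΣL-zero⁻ xs f (m+n≡0⇒n≡0 (f y) h) x∈

  ΣL-tabulate : ∀ k (g : Fin k → A) (f : A → ℕ) → ΣL (tabulate g) f ≡ ΣF k (λ x → f (g x))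
  ΣL-tabulate zero g f = refl
  ΣL-tabulate (suc k) g f =
    cong (f (g zero) +_) (trans (ΣL-tabulate k (λ x → g (suc x)) f) (sym (ΣL-tabulate k suc (λ x → f (g x)))))

  ΣF-suc : ∀ n (f : Fin (suc n) → ℕ) → ΣF (suc n) f ≡ f zero + ΣF n (λ x → f (suc x))
  ΣF-suc n f = cong (f zero +_) (ΣL-tabulate n suc f)

module Subsets where
  open import Data.Nat
  open import Data.Nat.Properties
  open import Data.Bool using (true; false)
  open import Data.Fin using (Fin; zero; suc)
  import Data.Fin as F
  open import Data.Fin.Subset using (Subset; _∈_; _∉_; _⊆_; ∣_∣; _∩_; _─_; ⊥)
  open import Data.Fin.Subset.Properties using (_∈?_; drop-∷-⊆; p⊆q⇒∣p∣≤∣q∣)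
  open import Data.Vec using ([]; _∷_; here; there)
  open import Relation.Nullary
  open import Relation.Binary.PropositionalEquality
  open import Data.Product using (∃; _,_; _×_)
  open import Data.Empty using (⊥-elim)
  open import Data.List using (allFin)
  open import Data.List.Membership.Propositional.Properties using (∈-allFin)
  open Sums

  private variable
    n : ℕ

  card : (S : Subset n) → ∣ S ∣ ≡ ΣF n (λ x → ind (x ∈? S))
  card [] = refl
  card {suc n} (true ∷ S) = trans (cong suc (card S)) (sym (ΣF-suc n (λ x → ind (x ∈? true ∷ S))))
  card {suc n} (false ∷ S) = trans (card S) (sym (ΣF-suc n (λ x → ind (x ∈? false ∷ S))))

  ind-∩ : ∀ (x : Fin n) (S T : Subset n) → ind (x ∈? S ∩ T) ≡ ind (x ∈? S) * ind (x ∈? T)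
  ind-∩ zero (true ∷ S) (true ∷ T) = refl
  ind-∩ zero (true ∷ S) (false ∷ T) = refl
  ind-∩ zero (false ∷ S) (t ∷ T) = refl
  ind-∩ (suc x) (s ∷ S) (t ∷ T) = ind-∩ x S T

  card-∩ : ∀ (S T : Subset n) → ∣ S ∩ T ∣ ≡ ΣF n (λ x → ind (x ∈? S) * ind (x ∈? T))
  card-∩ S T = trans (card (S ∩ T)) (ΣF-cong _ (λ x → ind-∩ x S T))

  card-split : ∀ (S T : Subset n) → ∣ S ∣ ≡ ∣ S ─ T ∣ + ∣ S ∩ T ∣
  card-split [] [] = refl
  card-split (true ∷ S) (true ∷ T) = trans (cong suc (card-split S T)) (sym (+-suc ∣ S ─ T ∣ ∣ S ∩ T ∣))
  card-split (true ∷ S) (false ∷ T) = cong suc (card-split S T)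
  card-split (false ∷ S) (true ∷ T) = card-split S T
  card-split (false ∷ S) (false ∷ T) = card-split S T

  ∩-─-assoc : ∀ (S T U : Subset n) → S ∩ (T ─ U) ≡ (S ∩ T) ─ U
  ∩-─-assoc [] [] [] = refl
  ∩-─-assoc (true ∷ S) (t ∷ T) (true ∷ U) = cong (false ∷_) (∩-─-assoc S T U)
  ∩-─-assoc (true ∷ S) (t ∷ T) (false ∷ U) = cong (t ∷_) (∩-─-assoc S T U)
  ∩-─-assoc (false ∷ S) (t ∷ T) (true ∷ U) = cong (false ∷_) (∩-─-assoc S T U)
  ∩-─-assoc (false ∷ S) (t ∷ T) (false ∷ U) = cong (false ∷_) (∩-─-assoc S T U)

  ∩-─-absorb : ∀ (S T : Subset n) → S ∩ (S ─ T) ≡ S ─ T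
  ∩-─-absorb [] [] = refl
  ∩-─-absorb (true ∷ S) (true ∷ T) = cong (false ∷_) (∩-─-absorb S T)
  ∩-─-absorb (false ∷ S) (true ∷ T) = cong (false ∷_) (∩-─-absorb S T)
  ∩-─-absorb (true ∷ S) (false ∷ T) = cong (true ∷_) (∩-─-absorb S T)
  ∩-─-absorb (false ∷ S) (false ∷ T) = cong (false ∷_) (∩-─-absorb S T)

  ∩-─-disjoint : ∀ (S T : Subset n) → T ∩ (S ─ T) ≡ ⊥
  ∩-─-disjoint [] [] = refl
  ∩-─-disjoint (s ∷ S) (true ∷ T) = cong (false ∷_) (∩-─-disjoint S T)
  ∩-─-disjoint (s ∷ S) (false ∷ T) = cong (false ∷_) (∩-─-disjoint S T)

  ─-∉ : ∀ {x : Fin n} (S T : Subset n) → x ∈ S ─ T → x ∉ T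
  ─-∉ (true ∷ S) (false ∷ T) here ()
  ─-∉ (s ∷ S) (t ∷ T) (there x∈) (there x∈T) = ─-∉ S T x∈ x∈T

  ⊆-card-≡ : ∀ {S T : Subset n} → S ⊆ T → ∣ T ∣ ≤ ∣ S ∣ → S ≡ T
  ⊆-card-≡ {S = []} {[]} _ _ = refl
  ⊆-card-≡ {S = true ∷ S} {true ∷ T} h le = cong (true ∷_) (⊆-card-≡ (drop-∷-⊆ h) (s≤s⁻¹ le))
  ⊆-card-≡ {S = false ∷ S} {false ∷ T} h le = cong (false ∷_) (⊆-card-≡ (drop-∷-⊆ h) le)
  ⊆-card-≡ {S = true ∷ S} {false ∷ T} h le with h here
  ... | ()
  ⊆-card-≡ {S = false ∷ S} {true ∷ T} h le = ⊥-elim (<⇒≱ (s≤s (p⊆q⇒∣p∣≤∣q∣ (drop-∷-⊆ h))) le)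

  card-at : ∀ (S : Subset n) (x : Fin n) → ∣ S ∣ ≡ ind (x ∈? S) + ΣF n (λ y → ind (¬? (y F.≟ x)) * ind (y ∈? S))
  card-at S x = trans (card S) (ΣF-split _ x (λ y → ind (y ∈? S)))

  nonempty : ∀ (S : Subset n) → 1 ≤ ∣ S ∣ → ∃ λ x → x ∈ S
  nonempty {n} S h with ΣL-pos (allFin n) (λ x → ind (x ∈? S)) (subst (1 ≤_) (card S) h)
  ... | x , _ , pos = x , ind-pos (x ∈? S) pos

  two-elems : ∀ (S : Subset n) → 2 ≤ ∣ S ∣ → ∃ λ x → ∃ λ y → x ∈ S × y ∈ S × x ≢ y
  two-elems {n} S h with nonempty S (≤-trans (s≤s z≤n) h)
  ... | x , x∈ with ΣL-pos (allFin n) others others-pos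
    where
    others : Fin n → ℕ
    others y = ind (¬? (y F.≟ x)) * ind (y ∈? S)
    others-pos : 0 < ΣF n others
    others-pos = +-cancelˡ-< 1 0 _ (subst (1 <_) (trans (card-at S x) (cong (_+ ΣF n others) (ind-yes (x ∈? S) x∈))) h)
  ... | y , _ , pos with ind-pos-* (¬? (y F.≟ x)) (y ∈? S) pos
  ...   | y≢x , y∈ = x , y , x∈ , y∈ , λ x≡y → y≢x (sym x≡y)

  one-elem : ∀ (S : Subset n) → ∣ S ∣ ≡ 1 → ∃ λ p → p ∈ S × (∀ y → y ∈ S → y ≡ p)
  one-elem {n} S h with nonempty S (≤-reflexive (sym h))
  ... | x , x∈ = x , x∈ , unique
    where
    others-zero : ΣF n (λ y → ind (¬? (y F.≟ x)) * ind (y ∈? S)) ≡ 0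
    others-zero = +-cancelˡ-≡ 1 _ _ (trans (sym (trans (card-at S x) (cong (_+ ΣF n (λ y → ind (¬? (y F.≟ x)) * ind (y ∈? S))) (ind-yes (x ∈? S) x∈)))) h)
    unique : ∀ y → y ∈ S → y ≡ x
    unique y y∈ with y F.≟ x | ΣL-zero⁻ (allFin n) _ others-zero (∈-allFin y)
    ... | yes y≡x | _ = y≡x
    ... | no _ | eq rewrite ind-yes (y ∈? S) y∈ with eq
    ... | ()

-- Closed sets and basic counts in a (v, k, 1)-BIBD.
module Steiner where
  open import Data.Nat
  open import Data.Nat.Properties
  open import Data.Fin using (Fin)
  import Data.Fin as F
  open import Data.Fin.Subset using (Subset; _∈_; _∉_; _⊆_; ∣_∣; _∩_; ⊤)
  open import Data.Fin.Subset.Properties using (_∈?_; _⊆?_; x∈p∩q⁻; x∈p∩q⁺; ∈⊤)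
  open import Data.List using (List; []; _∷_; filter; length; allFin)
  open import Data.List.Membership.Propositional using () renaming (_∈_ to _∈L_)
  open import Data.List.Membership.Propositional.Properties using (∈-filter⁺; ∈-filter⁻)
  open import Data.List.Relation.Unary.Any using (here)
  import Data.List.Relation.Unary.Unique.Propositional.Properties as Unique
  open import Relation.Nullary
  open import Relation.Nullary.Decidable using (_×-dec_)
  open import Relation.Binary.PropositionalEquality
  open import Data.Product using (∃; _,_; _×_; proj₁; proj₂)
  open import Data.Empty using (⊥-elim)
  open import Defs
  open Sums
  open Subsets

  private variable
    v : ℕ

  pairCount-sum : ∀ (Bs : List (Subset v)) x y → pairCount Bs x y ≡ ΣL Bs (λ B → ind (x ∈? B) * ind (y ∈? B))
  pairCount-sum Bs x y =
    trans (length-filter (λ B → (x ∈? B) ×-dec (y ∈? B)) Bs) (ΣL-cong Bs (λ B _ → ind-× (x ∈? B) (y ∈? B)))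

  block-through : ∀ (Bs : List (Subset v)) x y → pairCount Bs x y ≡ 1 → ∃ λ B → B ∈L Bs × x ∈ B × y ∈ B
  block-through Bs x y h with filter (λ B → (x ∈? B) ×-dec (y ∈? B)) Bs in eq
  ... | B ∷ [] with ∈-filter⁻ (λ B → (x ∈? B) ×-dec (y ∈? B)) {xs = Bs} (subst (B ∈L_) (sym eq) (here refl))
  ...   | B∈ , x∈B , y∈B = B , B∈ , x∈B , y∈B

  block-unique : ∀ (Bs : List (Subset v)) x y → pairCount Bs x y ≡ 1 → ∀ {B₁ B₂} → B₁ ∈L Bs → B₂ ∈L Bs →
                 x ∈ B₁ → y ∈ B₁ → x ∈ B₂ → y ∈ B₂ → B₁ ≡ B₂
  block-unique Bs x y h B₁∈ B₂∈ x₁ y₁ x₂ y₂ =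
    singleton-≡ h (∈-filter⁺ (λ B → (x ∈? B) ×-dec (y ∈? B)) B₁∈ (x₁ , y₁)) (∈-filter⁺ (λ B → (x ∈? B) ×-dec (y ∈? B)) B₂∈ (x₂ , y₂))
    where
    singleton-≡ : ∀ {A : Set} {xs : List A} {p q : A} → length xs ≡ 1 → p ∈L xs → q ∈L xs → p ≡ q
    singleton-≡ {xs = _ ∷ []} _ (here refl) (here refl) = refl

  module System (v k₁ : ℕ) (Bs : List (Subset v)) (bibd : IsBIBD v (suc k₁) 1 Bs) where
    k : ℕ
    k = suc k₁
    open IsDesign bibd

    line : ∀ x y → x ≢ y → pairCount Bs x y ≡ 1
    line x y x≢y = balanced x y ∈⊤ ∈⊤ x≢y

    Closed : Subset v → Set
    Closed S = ∀ {x y B} → x ∈ S → y ∈ S → x ≢ y → B ∈L Bs → x ∈ B → y ∈ B → B ⊆ S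

    closed-⊤ : Closed ⊤
    closed-⊤ _ _ _ _ _ _ _ = ∈⊤

    closed-∩ : ∀ {S T} → Closed S → Closed T → Closed (S ∩ T)
    closed-∩ {S} {T} cS cT x∈ y∈ x≢y B∈ x∈B y∈B z∈B =
      x∈p∩q⁺ (cS (proj₁ (x∈p∩q⁻ S T x∈)) (proj₁ (x∈p∩q⁻ S T y∈)) x≢y B∈ x∈B y∈B z∈B ,
              cT (proj₂ (x∈p∩q⁻ S T x∈)) (proj₂ (x∈p∩q⁻ S T y∈)) x≢y B∈ x∈B y∈B z∈B)

    -- The point set of a sub-BIBD is closed: its own block through x, y is the block through x, y.
    sub⇒closed : ∀ {D} → IsSubBIBD k Bs D → Closed D
    sub⇒closed (B' , B'⊆Bs , des) {x} {y} x∈ y∈ x≢y B∈ x∈B y∈B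
      with block-through B' x y (IsDesign.balanced des x y x∈ y∈ x≢y)
    ... | B″ , B″∈ , x∈B″ , y∈B″ with block-unique Bs x y (line x y x≢y) B∈ (B'⊆Bs B″ B″∈) x∈B y∈B x∈B″ y∈B″
    ...   | refl = IsDesign.blockInP des B″ B″∈

    degreeIn : Subset v → Fin v → ℕ
    degreeIn S x = ΣL Bs (λ B → ind (B ⊆? S) * ind (x ∈? B))

    blocksIn : Subset v → ℕ
    blocksIn S = ΣL Bs (λ B → ind (B ⊆? S))

    pairsIn : Subset v → Fin v → Fin v → ℕ
    pairsIn S x y = ΣL Bs (λ B → ind (B ⊆? S) * (ind (x ∈? B) * ind (y ∈? B)))

    pairsIn-closed : ∀ {S} → Closed S → ∀ {x y} → x ∈ S → y ∈ S → x ≢ y → pairsIn S x y ≡ 1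
    pairsIn-closed {S} cS {x} {y} x∈ y∈ x≢y =
      trans (ΣL-cong Bs inside) (trans (sym (pairCount-sum Bs x y)) (line x y x≢y))
      where
      inside : ∀ B → B ∈L Bs → ind (B ⊆? S) * (ind (x ∈? B) * ind (y ∈? B)) ≡ ind (x ∈? B) * ind (y ∈? B)
      inside B B∈ with x ∈? B | y ∈? B
      ... | yes x∈B | yes y∈B = cong (_* 1) (ind-yes (B ⊆? S) (cS x∈ y∈ x≢y B∈ x∈B y∈B))
      ... | yes _ | no _ = *-zeroʳ (ind (B ⊆? S))
      ... | no _ | _ = *-zeroʳ (ind (B ⊆? S))

    outside : ∀ {S : Subset v} y B → y ∉ S → ind (B ⊆? S) * ind (y ∈? B) ≡ 0
    outside {S} y B y∉ with B ⊆? S | y ∈? B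
    ... | yes B⊆S | yes y∈B = ⊥-elim (y∉ (B⊆S y∈B))
    ... | yes _ | no _ = refl
    ... | no _ | _ = refl

    degreeIn-outside : ∀ {S : Subset v} y → y ∉ S → degreeIn S y ≡ 0
    degreeIn-outside {S} y y∉ = trans (ΣL-cong Bs (λ B _ → outside {S} y B y∉)) (ΣL-zero Bs)

    pairsIn-outside : ∀ {S : Subset v} x y → y ∉ S → pairsIn S x y ≡ 0
    pairsIn-outside {S} x y y∉ = trans (ΣL-cong Bs vanish) (ΣL-zero Bs)
      where
      vanish : ∀ B → B ∈L Bs → ind (B ⊆? S) * (ind (x ∈? B) * ind (y ∈? B)) ≡ 0
      vanish B _ = begin
        ind (B ⊆? S) * (ind (x ∈? B) * ind (y ∈? B)) ≡⟨ cong (ind (B ⊆? S) *_) (*-comm (ind (x ∈? B)) _) ⟩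
        ind (B ⊆? S) * (ind (y ∈? B) * ind (x ∈? B)) ≡⟨ *-assoc (ind (B ⊆? S)) _ _ ⟨
        ind (B ⊆? S) * ind (y ∈? B) * ind (x ∈? B)   ≡⟨ cong (_* ind (x ∈? B)) (outside y B y∉) ⟩
        0                                            ∎
        where open ≡-Reasoning

    -- Counting the flags (y, B) with x, y ∈ B ⊆ S: every block has k points.
    flags : ∀ S x → ΣF v (pairsIn S x) ≡ degreeIn S x * k
    flags S x = begin
      ΣF v (pairsIn S x)                                                  ≡⟨ ΣL-swap (allFin v) Bs _ ⟩
      ΣL Bs (λ B → ΣF v (λ y → ind (B ⊆? S) * (ind (x ∈? B) * ind (y ∈? B)))) ≡⟨ ΣL-cong Bs perBlock ⟩
      ΣL Bs (λ B → ind (B ⊆? S) * ind (x ∈? B) * k)                        ≡⟨ ΣL-*ʳ Bs k _ ⟩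
      degreeIn S x * k                                                    ∎
      where
      open ≡-Reasoning
      perBlock : ∀ B → B ∈L Bs → ΣF v (λ y → ind (B ⊆? S) * (ind (x ∈? B) * ind (y ∈? B))) ≡ ind (B ⊆? S) * ind (x ∈? B) * k
      perBlock B B∈ = begin
        ΣF v (λ y → ind (B ⊆? S) * (ind (x ∈? B) * ind (y ∈? B))) ≡⟨ ΣL-*ˡ (allFin v) (ind (B ⊆? S)) _ ⟩
        ind (B ⊆? S) * ΣF v (λ y → ind (x ∈? B) * ind (y ∈? B))   ≡⟨ cong (ind (B ⊆? S) *_) (ΣL-*ˡ (allFin v) (ind (x ∈? B)) _) ⟩
        ind (B ⊆? S) * (ind (x ∈? B) * ΣF v (λ y → ind (y ∈? B))) ≡⟨ cong (λ z → ind (B ⊆? S) * (ind (x ∈? B) * z)) (trans (sym (card B)) (blockSize B B∈)) ⟩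
        ind (B ⊆? S) * (ind (x ∈? B) * k)                         ≡⟨ *-assoc (ind (B ⊆? S)) _ k ⟨
        ind (B ⊆? S) * ind (x ∈? B) * k                           ∎

    -- Replication inside a closed set: the blocks of S through x partition S ∖ {x}.
    replication : ∀ {S} → Closed S → ∀ {x} → x ∈ S → suc (degreeIn S x * k₁) ≡ ∣ S ∣
    replication {S} cS {x} x∈ = begin
      suc (degreeIn S x * k₁)  ≡⟨ cong suc (+-cancelˡ-≡ (degreeIn S x) _ _ (trans (sym (*-suc (degreeIn S x) k₁)) (trans (sym (flags S x)) flagsAt))) ⟩
      suc others               ≡⟨ sym (trans (card-at S x) (cong (_+ others) (ind-yes (x ∈? S) x∈))) ⟩
      ∣ S ∣                    ∎
      where
      open ≡-Reasoning
      others : ℕ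
      others = ΣF v (λ y → ind (¬? (y F.≟ x)) * ind (y ∈? S))
      atOther : ∀ y → ind (¬? (y F.≟ x)) * pairsIn S x y ≡ ind (¬? (y F.≟ x)) * ind (y ∈? S)
      atOther y with y F.≟ x | y ∈? S
      ... | yes _ | _ = refl
      ... | no y≢x | yes y∈ = cong (_+ 0) (pairsIn-closed cS x∈ y∈ (λ x≡y → y≢x (sym x≡y)))
      ... | no _ | no y∉ = cong (_+ 0) (pairsIn-outside x y y∉)
      flagsAt : ΣF v (pairsIn S x) ≡ degreeIn S x + others
      flagsAt = trans (ΣF-split v x (pairsIn S x))
                      (cong₂ _+_ (ΣL-cong Bs (λ B _ → cong (ind (B ⊆? S) *_) (ind-idem (x ∈? B)))) (ΣF-cong v atOther))

    blocksIn-closed : ∀ {S s} → Closed S → ∣ S ∣ ≡ suc s → blocksIn S * (k * k₁) ≡ suc s * s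
    blocksIn-closed {S} {s} cS |S| = +-cancelʳ-≡ (suc s) _ _ (begin
      blocksIn S * (k * k₁) + suc s                       ≡⟨ cong₂ _+_ (sym (*-assoc (blocksIn S) k k₁)) (sym |S|) ⟩
      blocksIn S * k * k₁ + ∣ S ∣                          ≡⟨ cong₂ _+_ (cong (_* k₁) incidences) (card S) ⟩
      ΣF v (degreeIn S) * k₁ + ΣF v (λ y → ind (y ∈? S))  ≡⟨ cong (_+ _) (sym (ΣL-*ʳ (allFin v) k₁ (degreeIn S))) ⟩
      ΣF v (λ y → degreeIn S y * k₁) + ΣF v (λ y → ind (y ∈? S)) ≡⟨ sym (ΣL-+ (allFin v) _ _) ⟩
      ΣF v (λ y → degreeIn S y * k₁ + ind (y ∈? S))        ≡⟨ ΣF-cong v perPoint ⟩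
      ΣF v (λ y → ind (y ∈? S) * suc s)                    ≡⟨ ΣL-*ʳ (allFin v) (suc s) _ ⟩
      ΣF v (λ y → ind (y ∈? S)) * suc s                    ≡⟨ cong (_* suc s) (trans (sym (card S)) |S|) ⟩
      suc s * suc s                                        ≡⟨ *-suc (suc s) s ⟩
      suc s + suc s * s                                    ≡⟨ +-comm (suc s) _ ⟩
      suc s * s + suc s                                    ∎)
      where
      open ≡-Reasoning
      incidences : blocksIn S * k ≡ ΣF v (degreeIn S)
      incidences = begin
        blocksIn S * k                                      ≡⟨ sym (ΣL-*ʳ Bs k _) ⟩
        ΣL Bs (λ B → ind (B ⊆? S) * k)                      ≡⟨ ΣL-cong Bs (λ B B∈ → cong (ind (B ⊆? S) *_) (sym (trans (sym (card B)) (blockSize B B∈)))) ⟩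
        ΣL Bs (λ B → ind (B ⊆? S) * ΣF v (λ y → ind (y ∈? B))) ≡⟨ ΣL-cong Bs (λ B _ → sym (ΣL-*ˡ (allFin v) (ind (B ⊆? S)) _)) ⟩
        ΣL Bs (λ B → ΣF v (λ y → ind (B ⊆? S) * ind (y ∈? B))) ≡⟨ ΣL-swap Bs (allFin v) _ ⟩
        ΣF v (degreeIn S)                                   ∎
      perPoint : ∀ y → degreeIn S y * k₁ + ind (y ∈? S) ≡ ind (y ∈? S) * suc s
      perPoint y with y ∈? S
      ... | yes y∈ = trans (+-comm _ 1) (trans (replication cS y∈) (trans |S| (sym (+-identityʳ (suc s)))))
      ... | no y∉ = cong (λ z → z * k₁ + 0) (degreeIn-outside y y∉)

    -- A closed set with more than k points carries a sub-BIBD: the blocks it contains.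
    closed⇒sub : ∀ {W} → Closed W → k < ∣ W ∣ → IsSubBIBD k Bs W
    closed⇒sub {W} cW k<∣W∣ = filter (_⊆? W) Bs , (λ B B∈ → proj₁ (∈-filter⁻ (_⊆? W) {xs = Bs} B∈)) , record
      { two≤k = two≤k
      ; k<size = k<∣W∣
      ; noRepeats = Unique.filter⁺ (_⊆? W) noRepeats
      ; blockInP = λ B B∈ → proj₂ (∈-filter⁻ (_⊆? W) {xs = Bs} B∈)
      ; blockSize = λ B B∈ → blockSize B (proj₁ (∈-filter⁻ (_⊆? W) {xs = Bs} B∈))
      ; balanced = λ x y x∈ y∈ x≢y → trans (pairCount-sum (filter (_⊆? W) Bs) x y)
                     (trans (ΣL-filter (_⊆? W) Bs _) (pairsIn-closed cW x∈ y∈ x≢y))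
      }

module Patterns where
  open import Data.Nat
  open import Data.Nat.Properties
  open import Data.Fin using (Fin; zero; suc)
  open import Data.Product using (∃; _×_; _,_; proj₁; proj₂)
  open import Data.Sum using (_⊎_; inj₁; inj₂)
  open import Relation.Binary.PropositionalEquality
  open import Data.Empty using (⊥-elim)

  -- An intersection pattern (x₁, x₂, x₃) records |D ∩ (D₁ ∖ D₂)|, |D ∩ D₁ ∩ D₂|, |D ∩ (D₂ ∖ D₁)|.
  Pattern : Set
  Pattern = ℕ × ℕ × ℕ

  -- Names for the thirteen patterns, numbered as a⁽¹⁾, …, a⁽¹³⁾ in the statement.
  pattern t₁ = zero
  pattern t₂ = suc t₁
  pattern t₃ = suc t₂
  pattern t₄ = suc t₃
  pattern t₅ = suc t₄
  pattern t₆ = suc t₅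
  pattern t₇ = suc t₆
  pattern t₈ = suc t₇
  pattern t₉ = suc t₈
  pattern t₁₀ = suc t₉
  pattern t₁₁ = suc t₁₀
  pattern t₁₂ = suc t₁₁
  pattern t₁₃ = suc t₁₂

  -- The thirteen patterns for block size k = suc (suc j).
  shape : ℕ → Fin 13 → Pattern
  shape j t₁ = (suc (suc j) , 0 , suc (suc j))
  shape j t₂ = (suc j , 1 , suc j)
  shape j t₃ = (suc (suc j) , 0 , 1)
  shape j t₄ = (1 , 0 , suc (suc j))
  shape j t₅ = (suc (suc j) , 0 , 0)
  shape j t₆ = (0 , 0 , suc (suc j))
  shape j t₇ = (suc j , 1 , 0)
  shape j t₈ = (0 , 1 , suc j)
  shape j t₉ = (1 , 0 , 1)
  shape j t₁₀ = (1 , 0 , 0)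
  shape j t₁₁ = (0 , 0 , 1)
  shape j t₁₂ = (0 , 1 , 0)
  shape j t₁₃ = (0 , 0 , 0)

  -- A left inverse of 'shape j', so distinct indices have distinct patterns.
  index : Pattern → Fin 13
  index (x₁ , x₂ , x₃) = go x₂ x₁ x₃
    where
    go : ℕ → ℕ → ℕ → Fin 13
    go zero zero zero = t₁₃
    go zero zero (suc zero) = t₁₁
    go zero zero (suc (suc _)) = t₆
    go zero (suc zero) zero = t₁₀
    go zero (suc zero) (suc zero) = t₉
    go zero (suc zero) (suc (suc _)) = t₄
    go zero (suc (suc _)) zero = t₅
    go zero (suc (suc _)) (suc zero) = t₃
    go zero (suc (suc _)) (suc (suc _)) = t₁
    go (suc _) zero zero = t₁₂
    go (suc _) zero (suc _) = t₈
    go (suc _) (suc _) zero = t₇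
    go (suc _) (suc _) (suc _) = t₂

  index-shape : ∀ j i → index (shape j i) ≡ i
  index-shape j t₁ = refl
  index-shape j t₂ = refl
  index-shape j t₃ = refl
  index-shape j t₄ = refl
  index-shape j t₅ = refl
  index-shape j t₆ = refl
  index-shape j t₇ = refl
  index-shape j t₈ = refl
  index-shape j t₉ = refl
  index-shape j t₁₀ = refl
  index-shape j t₁₁ = refl
  index-shape j t₁₂ = refl
  index-shape j t₁₃ = refl

  shape-injective : ∀ j a b → shape j a ≡ shape j b → a ≡ b
  shape-injective j a b eq = trans (sym (index-shape j a)) (trans (cong index eq) (index-shape j b))

  -- Sizes of intersections of two distinct minimal sub-BIBDs: 0, 1 or k.
  Admissible : ℕ → ℕ → Set
  Admissible j n = n ≡ 0 ⊎ n ≡ 1 ⊎ n ≡ suc (suc j)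

  classify : ∀ j x₁ x₂ x₃ → x₂ ≤ 1 → Admissible j (x₁ + x₂) → Admissible j (x₃ + x₂) → ∃ λ a → (x₁ , x₂ , x₃) ≡ shape j a
  classify j x₁ zero x₃ _ h₁ h₃ rewrite +-identityʳ x₁ | +-identityʳ x₃ = go h₁ h₃
    where
    go : Admissible j x₁ → Admissible j x₃ → ∃ λ a → (x₁ , 0 , x₃) ≡ shape j a
    go (inj₁ refl) (inj₁ refl) = t₁₃ , refl
    go (inj₁ refl) (inj₂ (inj₁ refl)) = t₁₁ , refl
    go (inj₁ refl) (inj₂ (inj₂ refl)) = t₆ , refl
    go (inj₂ (inj₁ refl)) (inj₁ refl) = t₁₀ , refl
    go (inj₂ (inj₁ refl)) (inj₂ (inj₁ refl)) = t₉ , refl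
    go (inj₂ (inj₁ refl)) (inj₂ (inj₂ refl)) = t₄ , refl
    go (inj₂ (inj₂ refl)) (inj₁ refl) = t₅ , refl
    go (inj₂ (inj₂ refl)) (inj₂ (inj₁ refl)) = t₃ , refl
    go (inj₂ (inj₂ refl)) (inj₂ (inj₂ refl)) = t₁ , refl
  classify j x₁ (suc zero) x₃ _ h₁ h₃ rewrite +-comm x₁ 1 | +-comm x₃ 1 = go h₁ h₃
    where
    go : Admissible j (suc x₁) → Admissible j (suc x₃) → ∃ λ a → (x₁ , 1 , x₃) ≡ shape j a
    go (inj₁ ()) _
    go _ (inj₁ ())
    go (inj₂ (inj₁ refl)) (inj₂ (inj₁ refl)) = t₁₂ , refl
    go (inj₂ (inj₁ refl)) (inj₂ (inj₂ refl)) = t₈ , refl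
    go (inj₂ (inj₂ refl)) (inj₂ (inj₁ refl)) = t₇ , refl
    go (inj₂ (inj₂ refl)) (inj₂ (inj₂ refl)) = t₂ , refl
  classify j x₁ (suc (suc x₂)) x₃ (s≤s ()) h₁ h₃

  inD₁ : ∀ j → Fin 13 → ℕ
  inD₁ j a = proj₁ (shape j a) + proj₁ (proj₂ (shape j a))

  -- For patterns where D ∩ D₁ is a block B: whether B avoids (avoid) or contains (through) the point D₁ ∩ D₂.
  avoid through : Fin 13 → ℕ
  avoid t₁ = 1
  avoid t₃ = 1
  avoid t₅ = 1
  avoid _ = 0
  through t₂ = 1
  through t₇ = 1
  through _ = 0

  weights-small : ∀ j a → inD₁ j a ≤ 1 → avoid a ≡ 0 × through a ≡ 0
  weights-small j t₁ (s≤s ())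
  weights-small j t₂ (s≤s h) = ⊥-elim (n≮0 (subst (_≤ 0) (+-comm j 1) h))
  weights-small j t₃ (s≤s ())
  weights-small j t₄ _ = refl , refl
  weights-small j t₅ (s≤s ())
  weights-small j t₆ _ = refl , refl
  weights-small j t₇ (s≤s h) = ⊥-elim (n≮0 (subst (_≤ 0) (+-comm j 1) h))
  weights-small j t₈ _ = refl , refl
  weights-small j t₉ _ = refl , refl
  weights-small j t₁₀ _ = refl , refl
  weights-small j t₁₁ _ = refl , refl
  weights-small j t₁₂ _ = refl , refl
  weights-small j t₁₃ _ = refl , refl

  weights-block : ∀ j a → inD₁ j a ≡ suc (suc j) → (avoid a + proj₁ (proj₂ (shape j a)) ≡ 1) × (through a ≡ proj₁ (proj₂ (shape j a)))
  weights-block j t₁ _ = refl , refl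
  weights-block j t₂ _ = refl , refl
  weights-block j t₃ _ = refl , refl
  weights-block j t₄ ()
  weights-block j t₅ _ = refl , refl
  weights-block j t₆ ()
  weights-block j t₇ _ = refl , refl
  weights-block j t₈ ()
  weights-block j t₉ ()
  weights-block j t₁₀ ()
  weights-block j t₁₁ ()
  weights-block j t₁₂ ()
  weights-block j t₁₃ ()

  reversed : Pattern → Pattern
  reversed (x₁ , x₂ , x₃) = (x₃ , x₂ , x₁)

  mirror : Fin 13 → Fin 13
  mirror t₃ = t₄
  mirror t₄ = t₃
  mirror t₅ = t₆
  mirror t₆ = t₅
  mirror t₇ = t₈
  mirror t₈ = t₇
  mirror t₁₀ = t₁₁
  mirror t₁₁ = t₁₀
  mirror i = i

  shape-mirror : ∀ j i → shape j (mirror i) ≡ reversed (shape j i)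
  shape-mirror j t₁ = refl
  shape-mirror j t₂ = refl
  shape-mirror j t₃ = refl
  shape-mirror j t₄ = refl
  shape-mirror j t₅ = refl
  shape-mirror j t₆ = refl
  shape-mirror j t₇ = refl
  shape-mirror j t₈ = refl
  shape-mirror j t₉ = refl
  shape-mirror j t₁₀ = refl
  shape-mirror j t₁₁ = refl
  shape-mirror j t₁₂ = refl
  shape-mirror j t₁₃ = refl

-- Double counting over the family 𝒟 of minimal sub-BIBDs.
module MinimalFamily where
  open import Data.Nat
  open import Data.Nat.Properties
  import Data.Nat as ℕ
  open import Data.Fin using (Fin)
  import Data.Fin as F
  open import Data.Fin.Subset using (Subset; _∈_; _⊆_; ∣_∣; _∩_; _─_; ⊤)
  open import Data.Fin.Subset.Properties using (_∈?_; _⊆?_; p⊆q⇒∣p∣≤∣q∣; x∈p∩q⁻; x∈p∩q⁺; ⊆⊤; p∩q⊆p; p∩q⊆q; ∣p∩q∣≤∣q∣; ∩-comm; ∩-assoc; ∩-idem; p─q⊆p; ∣⊤∣≡n; ∣⊥∣≡0)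
  open import Data.List using (List; length; filter; allFin)
  open import Data.List.Membership.Propositional using () renaming (_∈_ to _∈L_)
  open import Data.List.Relation.Unary.Unique.Propositional using (Unique)
  open import Data.Product using (∃; _×_; _,_; proj₁; proj₂)
  open import Data.Product.Properties using (≡-dec)
  open import Data.Sum using (_⊎_; inj₁; inj₂)
  open import Data.Empty using (⊥; ⊥-elim)
  open import Function.Bundles using (_⇔_; Equivalence)
  open import Relation.Nullary
  open import Relation.Nullary.Decidable using (_×-dec_)
  open import Relation.Binary.PropositionalEquality
  open import Defs
  open Sums
  open Subsets
  open Steiner
  open Patterns

  containing : ∀ {v} → List (Subset v) → Subset v → ℕ
  containing 𝒟 B = ΣL 𝒟 (λ D → ind (B ⊆? D))

  Ncount-swap : ∀ {v} (𝒟 : List (Subset v)) (D₁ D₂ : Subset v) x₁ x₂ x₃ →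
                Ncount 𝒟 D₂ D₁ x₃ x₂ x₁ ≡ Ncount 𝒟 D₁ D₂ x₁ x₂ x₃
  Ncount-swap 𝒟 D₁ D₂ x₁ x₂ x₃ = begin
    length (filter test₂₁ 𝒟)      ≡⟨ length-filter test₂₁ 𝒟 ⟩
    ΣL 𝒟 (λ D → ind (test₂₁ D))   ≡⟨ ΣL-cong 𝒟 (λ D _ → ind-⇔ (test₂₁ D) (test₁₂ D) (swap D₂ D₁ D) (swap D₁ D₂ D)) ⟩
    ΣL 𝒟 (λ D → ind (test₁₂ D))   ≡⟨ length-filter test₁₂ 𝒟 ⟨
    length (filter test₁₂ 𝒟)      ∎
    where
    open ≡-Reasoning
    test₁₂ : ∀ D → Dec _
    test₁₂ D = (¬? (D ≟S D₁)) ×-dec (¬? (D ≟S D₂)) ×-dec (∣ D ∩ (D₁ ─ D₂) ∣ ℕ.≟ x₁) ×-dec (∣ D ∩ D₁ ∩ D₂ ∣ ℕ.≟ x₂) ×-dec (∣ D ∩ (D₂ ─ D₁) ∣ ℕ.≟ x₃)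
    test₂₁ : ∀ D → Dec _
    test₂₁ D = (¬? (D ≟S D₂)) ×-dec (¬? (D ≟S D₁)) ×-dec (∣ D ∩ (D₂ ─ D₁) ∣ ℕ.≟ x₃) ×-dec (∣ D ∩ D₂ ∩ D₁ ∣ ℕ.≟ x₂) ×-dec (∣ D ∩ (D₁ ─ D₂) ∣ ℕ.≟ x₁)
    swap : ∀ {a b c} (S T D : Subset _) → (D ≢ S) × (D ≢ T) × (∣ D ∩ (S ─ T) ∣ ≡ a) × (∣ D ∩ S ∩ T ∣ ≡ b) × (∣ D ∩ (T ─ S) ∣ ≡ c) →
                                    (D ≢ T) × (D ≢ S) × (∣ D ∩ (T ─ S) ∣ ≡ c) × (∣ D ∩ T ∩ S ∣ ≡ b) × (∣ D ∩ (S ─ T) ∣ ≡ a)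
    swap S T D (≢S , ≢T , eqa , eqb , eqc) = ≢T , ≢S , eqc , trans (cong (λ X → ∣ D ∩ X ∣) (∩-comm T S)) eqb , eqa

  -- The setting of the theorem: 𝒟 lists the minimal sub-BIBDs, of size v' = suc w,
  -- of a (v, k, 1)-BIBD with k = suc (suc j), and every block lies in m of them.
  module Family (v j : ℕ) (Bs : List (Subset v)) (bibd : IsBIBD v (suc (suc j)) 1 Bs)
                (𝒟 : List (Subset v)) (𝒟-unique : Unique 𝒟)
                (𝒟-minimal : ∀ D → (D ∈L 𝒟) ⇔ IsMinimalSubBIBD (suc (suc j)) Bs D)
                (m : ℕ) (block-m : ∀ B → B ∈L Bs → blockCount 𝒟 B ≡ m)
                (w : ℕ) (size : ∀ D → D ∈L 𝒟 → ∣ D ∣ ≡ suc w) where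
    open System v (suc j) Bs bibd
    open IsDesign bibd

    minimal : ∀ {D} → D ∈L 𝒟 → IsMinimalSubBIBD k Bs D
    minimal {D} D∈ = Equivalence.to (𝒟-minimal D) D∈

    closed : ∀ {D} → D ∈L 𝒟 → Closed D
    closed D∈ = sub⇒closed (proj₁ (minimal D∈))

    containing-m : ∀ B → B ∈L Bs → containing 𝒟 B ≡ m
    containing-m B B∈ = trans (sym (length-filter (B ⊆?_) 𝒟)) (block-m B B∈)

    -- Two distinct minimal sub-BIBDs meet in at most one point or in a block: a larger
    -- intersection would be a closed set, hence a sub-BIBD, contradicting minimality.
    meet : ∀ {D E} → D ∈L 𝒟 → E ∈L 𝒟 → D ≢ E → ∣ D ∩ E ∣ ≤ 1 ⊎ (∃ λ B → B ∈L Bs × D ∩ E ≡ B)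
    meet {D} {E} D∈ E∈ D≢E with ∣ D ∩ E ∣ ≤? 1
    ... | yes ≤1 = inj₁ ≤1
    ... | no >1 with two-elems (D ∩ E) (≰⇒> >1)
    ... | x , y , x∈ , y∈ , x≢y with block-through Bs x y (line x y x≢y)
    ... | B , B∈ , x∈B , y∈B with ∣ D ∩ E ∣ ≤? k
    ... | yes ≤k = inj₂ (B , B∈ , sym (⊆-card-≡ B⊆D∩E (subst (∣ D ∩ E ∣ ≤_) (sym (blockSize B B∈)) ≤k)))
      where
      B⊆D∩E : B ⊆ D ∩ E
      B⊆D∩E = closed-∩ (closed D∈) (closed E∈) x∈ y∈ x≢y B∈ x∈B y∈B
    ... | no >k = ⊥-elim (D≢E (trans (sym (shrink D∈ (p∩q⊆p D E))) (shrink E∈ (p∩q⊆q D E))))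
      where
      sub : IsSubBIBD k Bs (D ∩ E)
      sub = closed⇒sub (closed-∩ (closed D∈) (closed E∈)) (≰⇒> >k)
      shrink : ∀ {F} → F ∈L 𝒟 → D ∩ E ⊆ F → D ∩ E ≡ F
      shrink F∈ ⊆F = ⊆-card-≡ ⊆F (proj₂ (proj₂ (minimal F∈)) (D ∩ E) sub (≰⇒> >k))

    admissible : ∀ {D E} → D ∈L 𝒟 → E ∈L 𝒟 → D ≢ E → Admissible j ∣ D ∩ E ∣
    admissible D∈ E∈ D≢E with meet D∈ E∈ D≢E
    ... | inj₂ (B , B∈ , D∩E≡B) = inj₂ (inj₂ (trans (cong ∣_∣ D∩E≡B) (blockSize B B∈)))
    ... | inj₁ ≤1 = small _ ≤1
      where
      small : ∀ n → n ≤ 1 → Admissible j n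
      small zero _ = inj₁ refl
      small (suc zero) _ = inj₂ (inj₁ refl)
      small (suc (suc _)) (s≤s ())

    blocksIn-minimal : ∀ {D} → D ∈L 𝒟 → blocksIn D * (k * suc j) ≡ suc w * w
    blocksIn-minimal D∈ = blocksIn-closed (closed D∈) (size _ D∈)

    -- Double counting pairs (B, D) with B ⊆ D ∈ 𝒟: |𝒟| · b(D) = m · b.
    family-size : ∀ {v₁} → v ≡ suc v₁ → length 𝒟 * (suc w * w) ≡ m * (v * v₁)
    family-size {v₁} v≡ = begin
      length 𝒟 * (suc w * w)                 ≡⟨ ΣL-const 𝒟 (suc w * w) ⟨
      ΣL 𝒟 (λ _ → suc w * w)                 ≡⟨ ΣL-cong 𝒟 (λ D D∈ → sym (blocksIn-minimal D∈)) ⟩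
      ΣL 𝒟 (λ D → blocksIn D * (k * suc j))  ≡⟨ ΣL-*ʳ 𝒟 (k * suc j) blocksIn ⟩
      ΣL 𝒟 blocksIn * (k * suc j)            ≡⟨ cong (_* (k * suc j)) incidences ⟩
      length Bs * m * (k * suc j)            ≡⟨ *-assoc (length Bs) m _ ⟩
      length Bs * (m * (k * suc j))          ≡⟨ cong (length Bs *_) (*-comm m _) ⟩
      length Bs * ((k * suc j) * m)          ≡⟨ *-assoc (length Bs) _ m ⟨
      length Bs * (k * suc j) * m            ≡⟨ cong (λ b → b * (k * suc j) * m) all-blocks ⟩
      blocksIn ⊤ * (k * suc j) * m           ≡⟨ cong (_* m) (blocksIn-closed closed-⊤ (trans (∣⊤∣≡n v) v≡)) ⟩
      suc v₁ * v₁ * m                        ≡⟨ cong (λ n → n * v₁ * m) (sym v≡) ⟩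
      v * v₁ * m                             ≡⟨ *-comm (v * v₁) m ⟩
      m * (v * v₁)                           ∎
      where
      open ≡-Reasoning
      incidences : ΣL 𝒟 blocksIn ≡ length Bs * m
      incidences = trans (ΣL-swap 𝒟 Bs (λ D B → ind (B ⊆? D)))
                         (trans (ΣL-cong Bs containing-m) (ΣL-const Bs m))
      all-blocks : length Bs ≡ blocksIn ⊤
      all-blocks = trans (sym (*-identityʳ (length Bs)))
                         (trans (sym (ΣL-const Bs 1)) (ΣL-cong Bs (λ B _ → sym (ind-yes (B ⊆? ⊤) ⊆⊤))))

    -- Every point lies in l members of 𝒟: counting pairs (B, D) with x ∈ B ⊆ D ∈ 𝒟
    -- gives l · (v' - 1)/(k - 1) = m · r, i.e. l (v' - 1) = m (v - 1).
    point-count : ∀ l → (∀ x → pointCount 𝒟 x ≡ l) → ∀ x → l * w ≡ m * (degreeIn ⊤ x * suc j)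
    point-count l l-const x = trans (sym byMembers) (trans (cong (_* suc j) byBlocks) (*-assoc m (degreeIn ⊤ x) (suc j)))
      where
      open ≡-Reasoning
      incid : ℕ
      incid = ΣL 𝒟 (λ D → ind (x ∈? D) * degreeIn D x)
      atMember : ∀ D → D ∈L 𝒟 → ind (x ∈? D) * degreeIn D x * suc j ≡ ind (x ∈? D) * w
      atMember D D∈ with x ∈? D
      ... | yes x∈ = trans (cong (_* suc j) (*-identityˡ (degreeIn D x)))
                            (trans (suc-injective (trans (replication (closed D∈) x∈) (size D D∈))) (sym (*-identityˡ w)))
      ... | no _ = refl
      byMembers : incid * suc j ≡ l * w
      byMembers = begin
        incid * suc j                            ≡⟨ ΣL-*ʳ 𝒟 (suc j) _ ⟨
        ΣL 𝒟 (λ D → ind (x ∈? D) * degreeIn D x * suc j) ≡⟨ ΣL-cong 𝒟 atMember ⟩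
        ΣL 𝒟 (λ D → ind (x ∈? D) * w)           ≡⟨ ΣL-*ʳ 𝒟 w _ ⟩
        ΣL 𝒟 (λ D → ind (x ∈? D)) * w           ≡⟨ cong (_* w) (trans (sym (length-filter (x ∈?_) 𝒟)) (l-const x)) ⟩
        l * w                                    ∎
      regroup : ∀ D B → ind (x ∈? D) * (ind (B ⊆? D) * ind (x ∈? B)) ≡ ind (x ∈? B) * ind (B ⊆? D)
      regroup D B with x ∈? B | B ⊆? D
      ... | no _ | B⊆?D = trans (cong (ind (x ∈? D) *_) (*-zeroʳ (ind B⊆?D))) (*-zeroʳ (ind (x ∈? D)))
      ... | yes _ | no _ = *-zeroʳ (ind (x ∈? D))
      ... | yes x∈B | yes B⊆D = cong (_* 1) (ind-yes (x ∈? D) (B⊆D x∈B))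
      byBlocks : incid ≡ m * degreeIn ⊤ x
      byBlocks = begin
        incid                                                        ≡⟨ ΣL-cong 𝒟 (λ D _ → sym (ΣL-*ˡ Bs (ind (x ∈? D)) _)) ⟩
        ΣL 𝒟 (λ D → ΣL Bs (λ B → ind (x ∈? D) * (ind (B ⊆? D) * ind (x ∈? B)))) ≡⟨ ΣL-swap 𝒟 Bs _ ⟩
        ΣL Bs (λ B → ΣL 𝒟 (λ D → ind (x ∈? D) * (ind (B ⊆? D) * ind (x ∈? B)))) ≡⟨ ΣL-cong Bs (λ B _ → ΣL-cong 𝒟 (λ D _ → regroup D B)) ⟩
        ΣL Bs (λ B → ΣL 𝒟 (λ D → ind (x ∈? B) * ind (B ⊆? D)))        ≡⟨ ΣL-cong Bs (λ B B∈ → trans (ΣL-*ˡ 𝒟 (ind (x ∈? B)) (λ D → ind (B ⊆? D))) (cong (ind (x ∈? B) *_) (containing-m B B∈))) ⟩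
        ΣL Bs (λ B → ind (x ∈? B) * m)                               ≡⟨ ΣL-*ʳ Bs m _ ⟩
        ΣL Bs (λ B → ind (x ∈? B)) * m                               ≡⟨ cong (_* m) (ΣL-cong Bs (λ B _ → sym (trans (cong (_* ind (x ∈? B)) (ind-yes (B ⊆? ⊤) ⊆⊤)) (*-identityˡ _)))) ⟩
        degreeIn ⊤ x * m                                             ≡⟨ *-comm _ m ⟩
        m * degreeIn ⊤ x                                             ∎

    module Pair (D₁ D₂ : Subset v) (D₁∈ : D₁ ∈L 𝒟) (D₂∈ : D₂ ∈L 𝒟) (one-point : ∣ D₁ ∩ D₂ ∣ ≡ 1) where

      -- D₁ ≠ D₂, since |D₁| > k ≥ 2 but |D₁ ∩ D₂| = 1.
      D₁≢D₂ : D₁ ≢ D₂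
      D₁≢D₂ D₁≡D₂ = <⇒≱ (proj₁ (proj₂ (minimal D₁∈))) (subst (_≤ k) (sym |D₁|≡1) (s≤s z≤n))
        where
        |D₁|≡1 : ∣ D₁ ∣ ≡ 1
        |D₁|≡1 = trans (sym (cong ∣_∣ (∩-idem D₁))) (trans (cong (λ D → ∣ D₁ ∩ D ∣) D₁≡D₂) one-point)

      p : Fin v
      p = proj₁ (one-elem (D₁ ∩ D₂) one-point)

      p∈D₁∩D₂ : p ∈ D₁ ∩ D₂
      p∈D₁∩D₂ = proj₁ (proj₂ (one-elem (D₁ ∩ D₂) one-point))

      p-unique : ∀ y → y ∈ D₁ ∩ D₂ → y ≡ p
      p-unique = proj₂ (proj₂ (one-elem (D₁ ∩ D₂) one-point))

      p∈D₁ : p ∈ D₁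
      p∈D₁ = proj₁ (x∈p∩q⁻ D₁ D₂ p∈D₁∩D₂)

      p∈D₂ : p ∈ D₂
      p∈D₂ = proj₂ (x∈p∩q⁻ D₁ D₂ p∈D₁∩D₂)

      left middle right : Subset v → ℕ
      left D = ∣ D ∩ (D₁ ─ D₂) ∣
      middle D = ∣ D ∩ D₁ ∩ D₂ ∣
      right D = ∣ D ∩ (D₂ ─ D₁) ∣

      patternOf : Subset v → Pattern
      patternOf D = (left D , middle D , right D)

      restrict-split : ∀ (D S T : Subset v) → ∣ D ∩ (S ─ T) ∣ + ∣ D ∩ S ∩ T ∣ ≡ ∣ D ∩ S ∣
      restrict-split D S T = begin
        ∣ D ∩ (S ─ T) ∣ + ∣ D ∩ S ∩ T ∣       ≡⟨ cong₂ (λ X Y → ∣ X ∣ + ∣ Y ∣) (∩-─-assoc D S T) (sym (∩-assoc D S T)) ⟩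
        ∣ (D ∩ S) ─ T ∣ + ∣ (D ∩ S) ∩ T ∣     ≡⟨ sym (card-split (D ∩ S) T) ⟩
        ∣ D ∩ S ∣                              ∎
        where open ≡-Reasoning

      left+middle : ∀ D → left D + middle D ≡ ∣ D ∩ D₁ ∣
      left+middle D = restrict-split D D₁ D₂

      right+middle : ∀ D → right D + middle D ≡ ∣ D ∩ D₂ ∣
      right+middle D = trans (cong (λ X → right D + ∣ D ∩ X ∣) (∩-comm D₁ D₂)) (restrict-split D D₂ D₁)

      middle-p : ∀ D → middle D ≡ ind (p ∈? D)
      middle-p D = begin
        middle D                                                   ≡⟨ card-∩ D (D₁ ∩ D₂) ⟩
        ΣF v (λ x → ind (x ∈? D) * ind (x ∈? D₁ ∩ D₂))            ≡⟨ ΣF-cong v (λ x → cong (ind (x ∈? D) *_) (ind-⇔ (x ∈? D₁ ∩ D₂) (x F.≟ p) (p-unique x) (λ { refl → p∈D₁∩D₂ }))) ⟩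
        ΣF v (λ x → ind (x ∈? D) * ind (x F.≟ p))                 ≡⟨ ΣF-cong v (λ x → *-comm (ind (x ∈? D)) _) ⟩
        ΣF v (λ x → ind (x F.≟ p) * ind (x ∈? D))                 ≡⟨ ΣF-pick v p (λ x → ind (x ∈? D)) ⟩
        ind (p ∈? D)                                               ∎
        where open ≡-Reasoning

      middle≤1 : ∀ D → middle D ≤ 1
      middle≤1 D = subst (middle D ≤_) one-point (∣p∩q∣≤∣q∣ D (D₁ ∩ D₂))

      classified : ∀ {D} → D ∈L 𝒟 → D ≢ D₁ → D ≢ D₂ → ∃ λ a → patternOf D ≡ shape j a
      classified {D} D∈ D≢D₁ D≢D₂ = classify j (left D) (middle D) (right D) (middle≤1 D)
        (subst (Admissible j) (sym (left+middle D)) (admissible D∈ D₁∈ D≢D₁))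
        (subst (Admissible j) (sym (right+middle D)) (admissible D∈ D₂∈ D≢D₂))

      other : Subset v → ℕ
      other D = ind (¬? (D ≟S D₁)) * ind (¬? (D ≟S D₂))

      split-family : ∀ (f : Subset v → ℕ) → ΣL 𝒟 f ≡ f D₁ + f D₂ + ΣL 𝒟 (λ D → other D * f D)
      split-family f = begin
        ΣL 𝒟 f                                                          ≡⟨ ΣL-cong 𝒟 (λ D _ → partition D) ⟩
        ΣL 𝒟 (λ D → (is₁ D + is₂ D) + other D * f D)                    ≡⟨ ΣL-+ 𝒟 _ _ ⟩
        ΣL 𝒟 (λ D → is₁ D + is₂ D) + ΣL 𝒟 (λ D → other D * f D)        ≡⟨ cong (_+ ΣL 𝒟 (λ D → other D * f D)) (ΣL-+ 𝒟 is₁ is₂) ⟩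
        ΣL 𝒟 is₁ + ΣL 𝒟 is₂ + ΣL 𝒟 (λ D → other D * f D)              ≡⟨ cong (λ s → s + ΣL 𝒟 (λ D → other D * f D))
                                                                              (cong₂ _+_ (ΣL-pick _≟S_ f 𝒟-unique D₁∈) (ΣL-pick _≟S_ f 𝒟-unique D₂∈)) ⟩
        f D₁ + f D₂ + ΣL 𝒟 (λ D → other D * f D)                        ∎
        where
        open ≡-Reasoning
        is₁ is₂ : Subset v → ℕ
        is₁ D = ind (D ≟S D₁) * f D
        is₂ D = ind (D ≟S D₂) * f D
        partition : ∀ D → f D ≡ (is₁ D + is₂ D) + other D * f D
        partition D with D ≟S D₁ | D ≟S D₂
        ... | yes refl | yes D₁≡D₂ = ⊥-elim (D₁≢D₂ D₁≡D₂)
        ... | yes _ | no _ = sym (trans (+-identityʳ _) (trans (+-identityʳ _) (+-identityʳ _)))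
        ... | no _ | yes _ = sym (trans (+-identityʳ _) (+-identityʳ _))
        ... | no _ | no _ = sym (+-identityʳ _)

      N : Fin 13 → ℕ
      N i = Ncount 𝒟 D₁ D₂ (proj₁ (shape j i)) (proj₁ (proj₂ (shape j i))) (proj₂ (proj₂ (shape j i)))

      _≟P_ : (P Q : Pattern) → Dec (P ≡ Q)
      _≟P_ = ≡-dec ℕ._≟_ (≡-dec ℕ._≟_ ℕ._≟_)

      Ncount-sum : ∀ x₁ x₂ x₃ → Ncount 𝒟 D₁ D₂ x₁ x₂ x₃ ≡ ΣL 𝒟 (λ D → other D * ind (patternOf D ≟P (x₁ , x₂ , x₃)))
      Ncount-sum x₁ x₂ x₃ = trans (length-filter test 𝒟) (ΣL-cong 𝒟 (λ D _ → ind-test D))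
        where
        sameSizes : ∀ D → Dec _
        sameSizes D = (left D ℕ.≟ x₁) ×-dec (middle D ℕ.≟ x₂) ×-dec (right D ℕ.≟ x₃)
        test : ∀ D → Dec _
        test D = (¬? (D ≟S D₁)) ×-dec (¬? (D ≟S D₂)) ×-dec sameSizes D
        ind-test : ∀ D → ind (test D) ≡ other D * ind (patternOf D ≟P (x₁ , x₂ , x₃))
        ind-test D = begin
          ind (test D)                                                       ≡⟨ ind-× (¬? (D ≟S D₁)) ((¬? (D ≟S D₂)) ×-dec sameSizes D) ⟩
          ind (¬? (D ≟S D₁)) * ind ((¬? (D ≟S D₂)) ×-dec sameSizes D)         ≡⟨ cong (ind (¬? (D ≟S D₁)) *_) (ind-× (¬? (D ≟S D₂)) (sameSizes D)) ⟩
          ind (¬? (D ≟S D₁)) * (ind (¬? (D ≟S D₂)) * ind (sameSizes D))       ≡⟨ *-assoc (ind (¬? (D ≟S D₁))) (ind (¬? (D ≟S D₂))) (ind (sameSizes D)) ⟨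
          other D * ind (sameSizes D)                                        ≡⟨ cong (other D *_) (ind-⇔ (sameSizes D) (patternOf D ≟P (x₁ , x₂ , x₃))
                                                                                  (λ { (refl , refl , refl) → refl }) (λ { refl → refl , refl , refl })) ⟩
          other D * ind (patternOf D ≟P (x₁ , x₂ , x₃))                      ∎
          where open ≡-Reasoning

      sum-by-pattern : (h : Subset v → ℕ) (g : Fin 13 → ℕ) →
                       (∀ {D} a → D ∈L 𝒟 → D ≢ D₁ → D ≢ D₂ → patternOf D ≡ shape j a → h D ≡ g a) →
                       ΣL 𝒟 (λ D → other D * h D) ≡ ΣF 13 (λ i → g i * N i)
      sum-by-pattern h g h≡g = sym (begin
        ΣF 13 (λ i → g i * N i)                                ≡⟨ ΣF-cong 13 (λ i → cong (g i *_) (Ncount-sum (proj₁ (shape j i)) (proj₁ (proj₂ (shape j i))) (proj₂ (proj₂ (shape j i))))) ⟩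
        ΣF 13 (λ i → g i * ΣL 𝒟 (λ D → other D * is D i))     ≡⟨ ΣF-cong 13 (λ i → sym (ΣL-*ˡ 𝒟 (g i) (λ D → other D * is D i))) ⟩
        ΣF 13 (λ i → ΣL 𝒟 (λ D → g i * (other D * is D i)))   ≡⟨ ΣL-swap (allFin 13) 𝒟 (λ i D → g i * (other D * is D i)) ⟩
        ΣL 𝒟 (λ D → ΣF 13 (λ i → g i * (other D * is D i)))   ≡⟨ ΣL-cong 𝒟 perMember ⟩
        ΣL 𝒟 (λ D → other D * h D)                             ∎)
        where
        open ≡-Reasoning
        is : Subset v → Fin 13 → ℕ
        is D i = ind (patternOf D ≟P shape j i)
        perMember : ∀ D → D ∈L 𝒟 → ΣF 13 (λ i → g i * (other D * is D i)) ≡ other D * h D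
        perMember D D∈ with D ≟S D₁ | D ≟S D₂
        ... | yes _ | _ = trans (ΣF-cong 13 (λ i → *-zeroʳ (g i))) (ΣL-zero (allFin 13))
        ... | no _ | yes _ = trans (ΣF-cong 13 (λ i → *-zeroʳ (g i))) (ΣL-zero (allFin 13))
        ... | no D≢D₁ | no D≢D₂ with classified D∈ D≢D₁ D≢D₂
        ...   | a , pattern≡ = begin
          ΣF 13 (λ i → g i * (1 * is D i))    ≡⟨ ΣF-cong 13 (λ i → trans (cong (g i *_) (trans (*-identityˡ (is D i)) (delta i))) (*-comm (g i) (ind (i F.≟ a)))) ⟩
          ΣF 13 (λ i → ind (i F.≟ a) * g i)   ≡⟨ ΣF-pick 13 a g ⟩
          g a                                 ≡⟨ sym (h≡g a D∈ D≢D₁ D≢D₂ pattern≡) ⟩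
          h D                                 ≡⟨ sym (*-identityˡ (h D)) ⟩
          1 * h D                             ∎
          where
          delta : ∀ i → is D i ≡ ind (i F.≟ a)
          delta i = ind-⇔ (patternOf D ≟P shape j i) (i F.≟ a)
                      (λ e → sym (shape-injective j a i (trans (sym pattern≡) e))) (λ { refl → pattern≡ })

      outside-one : ∀ {S T : Subset v} → ∣ S ∣ ≡ suc w → ∣ S ∩ T ∣ ≡ 1 → ∣ S ─ T ∣ ≡ w
      outside-one {S} {T} |S| |S∩T| =
        suc-injective (trans (+-comm 1 _) (trans (cong (∣ S ─ T ∣ +_) (sym |S∩T|)) (trans (sym (card-split S T)) |S|)))

      |D₁─D₂| : ∣ D₁ ─ D₂ ∣ ≡ w
      |D₁─D₂| = outside-one {D₁} {D₂} (size D₁ D₁∈) one-point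

      |D₂─D₁| : ∣ D₂ ─ D₁ ∣ ≡ w
      |D₂─D₁| = outside-one {D₂} {D₁} (size D₂ D₂∈) (trans (cong ∣_∣ (∩-comm D₂ D₁)) one-point)

      left-D₁ : left D₁ ≡ w
      left-D₁ = trans (cong ∣_∣ (∩-─-absorb D₁ D₂)) |D₁─D₂|

      left-D₂ : left D₂ ≡ 0
      left-D₂ = trans (cong ∣_∣ (∩-─-disjoint D₁ D₂)) (∣⊥∣≡0 v)

      right-D₁ : right D₁ ≡ 0
      right-D₁ = trans (cong ∣_∣ (∩-─-disjoint D₂ D₁)) (∣⊥∣≡0 v)

      family-by-pattern : length 𝒟 ≡ 2 + ΣF 13 (λ i → 1 * N i)
      family-by-pattern = begin
        length 𝒟                                   ≡⟨ sym (trans (ΣL-const 𝒟 1) (*-identityʳ (length 𝒟))) ⟩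
        ΣL 𝒟 (λ _ → 1)                             ≡⟨ split-family (λ _ → 1) ⟩
        2 + ΣL 𝒟 (λ D → other D * 1)               ≡⟨ cong (2 +_) (sum-by-pattern (λ _ → 1) (λ _ → 1) (λ _ _ _ _ _ → refl)) ⟩
        2 + ΣF 13 (λ i → 1 * N i)                  ∎
        where open ≡-Reasoning

      crossing-distinct : ∀ {x y} → x ∈ D₁ ─ D₂ → y ∈ D₂ ─ D₁ → x ≢ y
      crossing-distinct {x} x∈ y∈ refl = ─-∉ D₁ D₂ x∈ (p─q⊆p D₂ D₁ y∈)

      crossing-pair : ∀ {x y} → x ∈ D₁ ─ D₂ → y ∈ D₂ ─ D₁ → ΣL 𝒟 (λ D → ind (x ∈? D) * ind (y ∈? D)) ≡ m
      crossing-pair {x} {y} x∈ y∈ with block-through Bs x y (line x y (crossing-distinct x∈ y∈))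
      ... | B , B∈ , x∈B , y∈B = trans (ΣL-cong 𝒟 contains-B) (containing-m B B∈)
        where
        contains-B : ∀ D → D ∈L 𝒟 → ind (x ∈? D) * ind (y ∈? D) ≡ ind (B ⊆? D)
        contains-B D D∈ with B ⊆? D
        ... | yes B⊆D = cong₂ _*_ (ind-yes (x ∈? D) (B⊆D x∈B)) (ind-yes (y ∈? D) (B⊆D y∈B))
        ... | no B⊈D with x ∈? D | y ∈? D
        ...   | yes x∈D | yes y∈D = ⊥-elim (B⊈D (closed D∈ x∈D y∈D (crossing-distinct x∈ y∈) B∈ x∈B y∈B))
        ...   | yes _ | no _ = refl
        ...   | no _ | _ = refl

      crossing-flag : Fin v → Fin v → Subset v → ℕ
      crossing-flag x y D = (ind (x ∈? D₁ ─ D₂) * ind (x ∈? D)) * (ind (y ∈? D₂ ─ D₁) * ind (y ∈? D))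

      -- For fixed x, y, the flags are the m members through the block xy (or none).
      crossing-by-points : ∀ x y → ind (x ∈? D₁ ─ D₂) * (ind (y ∈? D₂ ─ D₁) * m) ≡ ΣL 𝒟 (crossing-flag x y)
      crossing-by-points x y with x ∈? D₁ ─ D₂ | y ∈? D₂ ─ D₁
      ... | yes x∈ | yes y∈ = begin
        1 * (1 * m)                                       ≡⟨ trans (*-identityˡ _) (*-identityˡ m) ⟩
        m                                                 ≡⟨ sym (crossing-pair x∈ y∈) ⟩
        ΣL 𝒟 (λ D → ind (x ∈? D) * ind (y ∈? D))          ≡⟨ ΣL-cong 𝒟 (λ D _ → cong₂ _*_ (sym (*-identityˡ (ind (x ∈? D)))) (sym (*-identityˡ (ind (y ∈? D))))) ⟩
        ΣL 𝒟 (λ D → (1 * ind (x ∈? D)) * (1 * ind (y ∈? D))) ∎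
        where open ≡-Reasoning
      ... | yes _ | no _ = sym (trans (ΣL-cong 𝒟 (λ D _ → *-zeroʳ (1 * ind (x ∈? D)))) (ΣL-zero 𝒟))
      ... | no _ | _ = sym (ΣL-zero 𝒟)

      crossing-by-member : ∀ D → ΣF v (λ x → ΣF v (λ y → crossing-flag x y D)) ≡ left D * right D
      crossing-by-member D = begin
        ΣF v (λ x → ΣF v (λ y → crossing-flag x y D))           ≡⟨ ΣF-cong v (λ x → ΣL-*ˡ (allFin v) (I x A) (λ y → I y C)) ⟩
        ΣF v (λ x → I x A * ΣF v (λ y → I y C))                ≡⟨ ΣL-*ʳ (allFin v) _ (λ x → I x A) ⟩
        ΣF v (λ x → I x A) * ΣF v (λ y → I y C)                ≡⟨ sym (cong₂ _*_ (trans (cong ∣_∣ (∩-comm D (D₁ ─ D₂))) (card-∩ (D₁ ─ D₂) D))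
                                                                                  (trans (cong ∣_∣ (∩-comm D (D₂ ─ D₁))) (card-∩ (D₂ ─ D₁) D))) ⟩
        left D * right D                                       ∎
        where
        open ≡-Reasoning
        I : Fin v → Subset v → ℕ
        I x S = ind (x ∈? S) * ind (x ∈? D)
        A C : Subset v
        A = D₁ ─ D₂
        C = D₂ ─ D₁

      -- Counting the flags both ways: w² · m = Σᵢ x₁ x₃ Nᵢ.
      crossing-pairs : w * w * m ≡ ΣF 13 (λ i → (proj₁ (shape j i) * proj₂ (proj₂ (shape j i))) * N i)
      crossing-pairs = begin
        w * w * m                                         ≡⟨ cong₂ (λ a b → a * b * m) (trans (sym |D₁─D₂|) (card A)) (trans (sym |D₂─D₁|) (card C)) ⟩
        ΣF v (λ x → I x A) * ΣF v (λ y → I y C) * m       ≡⟨ *-assoc (ΣF v (λ x → I x A)) _ m ⟩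
        ΣF v (λ x → I x A) * (ΣF v (λ y → I y C) * m)     ≡⟨ sym (ΣL-*ʳ (allFin v) _ (λ x → I x A)) ⟩
        ΣF v (λ x → I x A * (ΣF v (λ y → I y C) * m))     ≡⟨ ΣF-cong v (λ x → cong (I x A *_) (sym (ΣL-*ʳ (allFin v) m (λ y → I y C)))) ⟩
        ΣF v (λ x → I x A * ΣF v (λ y → I y C * m))       ≡⟨ ΣF-cong v (λ x → sym (ΣL-*ˡ (allFin v) (I x A) (λ y → I y C * m))) ⟩
        ΣF v (λ x → ΣF v (λ y → I x A * (I y C * m)))     ≡⟨ ΣF-cong v (λ x → ΣF-cong v (λ y → crossing-by-points x y)) ⟩
        ΣF v (λ x → ΣF v (λ y → ΣL 𝒟 (crossing-flag x y))) ≡⟨ ΣF-cong v (λ x → ΣL-swap (allFin v) 𝒟 (crossing-flag x)) ⟩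
        ΣF v (λ x → ΣL 𝒟 (λ D → ΣF v (λ y → crossing-flag x y D))) ≡⟨ ΣL-swap (allFin v) 𝒟 (λ x D → ΣF v (λ y → crossing-flag x y D)) ⟩
        ΣL 𝒟 (λ D → ΣF v (λ x → ΣF v (λ y → crossing-flag x y D))) ≡⟨ ΣL-cong 𝒟 (λ D _ → crossing-by-member D) ⟩
        ΣL 𝒟 (λ D → left D * right D)                      ≡⟨ split-family (λ D → left D * right D) ⟩
        left D₁ * right D₁ + left D₂ * right D₂ + ΣL 𝒟 (λ D → other D * (left D * right D))
          ≡⟨ cong₂ _+_ (cong₂ _+_ (trans (cong (left D₁ *_) right-D₁) (*-zeroʳ (left D₁))) (cong (_* right D₂) left-D₂))
                       (sum-by-pattern (λ D → left D * right D) (λ i → proj₁ (shape j i) * proj₂ (proj₂ (shape j i)))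
                                       (λ a _ _ _ pattern≡ → cong (λ P → proj₁ P * proj₂ (proj₂ P)) pattern≡)) ⟩
        ΣF 13 (λ i → (proj₁ (shape j i) * proj₂ (proj₂ (shape j i))) * N i) ∎
        where
        open ≡-Reasoning
        A C : Subset v
        A = D₁ ─ D₂
        C = D₂ ─ D₁
        I : Fin v → Subset v → ℕ
        I x S = ind (x ∈? S)

      no-block-in-small : ∀ {B S} → B ∈L Bs → B ⊆ S → ∣ S ∣ ≤ 1 → ⊥
      no-block-in-small {B} B∈ B⊆S ∣S∣≤1 =
        <⇒≱ (s≤s (s≤s z≤n)) (≤-trans (subst (_≤ _) (blockSize B B∈) (p⊆q⇒∣p∣≤∣q∣ B⊆S)) ∣S∣≤1)

      -- For a weight Y on blocks, count pairs (B, D) with B ⊆ D₁ and B ⊆ D ∈ 𝒟, weighted by Y B.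
      module BlockWeights (Y : Subset v → ℕ) where
        weight : Subset v → ℕ
        weight B = ind (B ⊆? D₁) * Y B

        inside : Subset v → ℕ
        inside D = ΣL Bs (λ B → weight B * ind (B ⊆? D))

        double-count : m * ΣL Bs weight ≡ ΣL 𝒟 inside
        double-count = begin
          m * ΣL Bs weight                                  ≡⟨ *-comm m _ ⟩
          ΣL Bs weight * m                                  ≡⟨ sym (ΣL-*ʳ Bs m weight) ⟩
          ΣL Bs (λ B → weight B * m)                        ≡⟨ ΣL-cong Bs (λ B B∈ → cong (weight B *_) (sym (containing-m B B∈))) ⟩
          ΣL Bs (λ B → weight B * containing 𝒟 B)           ≡⟨ ΣL-cong Bs (λ B _ → sym (ΣL-*ˡ 𝒟 (weight B) (λ D → ind (B ⊆? D)))) ⟩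
          ΣL Bs (λ B → ΣL 𝒟 (λ D → weight B * ind (B ⊆? D))) ≡⟨ ΣL-swap Bs 𝒟 (λ B D → weight B * ind (B ⊆? D)) ⟩
          ΣL 𝒟 inside                                       ∎
          where open ≡-Reasoning

        inside-D₁ : inside D₁ ≡ ΣL Bs weight
        inside-D₁ = ΣL-cong Bs term
          where
          term : ∀ B → B ∈L Bs → weight B * ind (B ⊆? D₁) ≡ weight B
          term B _ with B ⊆? D₁
          ... | yes _ = *-identityʳ _
          ... | no _ = refl

        inside-small : ∀ D → ∣ D ∩ D₁ ∣ ≤ 1 → inside D ≡ 0
        inside-small D ≤1 = trans (ΣL-cong Bs term) (ΣL-zero Bs)
          where
          term : ∀ B → B ∈L Bs → weight B * ind (B ⊆? D) ≡ 0
          term B B∈ with B ⊆? D₁ | B ⊆? D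
          ... | yes B⊆D₁ | yes B⊆D = ⊥-elim (no-block-in-small B∈ (λ x∈B → x∈p∩q⁺ (B⊆D x∈B , B⊆D₁ x∈B)) ≤1)
          ... | yes _ | no _ = *-zeroʳ (1 * Y B)
          ... | no _ | _ = refl

        inside-block : ∀ D B₀ → B₀ ∈L Bs → D ∩ D₁ ≡ B₀ → inside D ≡ Y B₀
        inside-block D B₀ B₀∈ D∩D₁≡B₀ = trans (ΣL-cong Bs term) (ΣL-pick _≟S_ (λ _ → Y B₀) noRepeats B₀∈)
          where
          B₀⊆D : B₀ ⊆ D
          B₀⊆D x∈ = p∩q⊆p D D₁ (subst (_ ∈_) (sym D∩D₁≡B₀) x∈)
          B₀⊆D₁ : B₀ ⊆ D₁
          B₀⊆D₁ x∈ = p∩q⊆q D D₁ (subst (_ ∈_) (sym D∩D₁≡B₀) x∈)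
          term : ∀ B → B ∈L Bs → weight B * ind (B ⊆? D) ≡ ind (B ≟S B₀) * Y B₀
          term B B∈ with B ≟S B₀
          term B B∈ | yes refl with B ⊆? D₁ | B ⊆? D
          ... | yes _ | yes _ = *-identityʳ _
          ... | no B⊈D₁ | _ = ⊥-elim (B⊈D₁ B₀⊆D₁)
          ... | yes _ | no B⊈D = ⊥-elim (B⊈D B₀⊆D)
          term B B∈ | no B≢B₀ with B ⊆? D₁ | B ⊆? D
          ... | yes B⊆D₁ | yes B⊆D = ⊥-elim (B≢B₀ (⊆-card-≡ (λ x∈ → subst (_ ∈_) D∩D₁≡B₀ (x∈p∩q⁺ (B⊆D x∈ , B⊆D₁ x∈)))
                                                            (≤-reflexive (trans (blockSize B₀ B₀∈) (sym (blockSize B B∈))))))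
          ... | yes _ | no _ = *-zeroʳ (1 * Y B)
          ... | no _ | _ = refl

        -- D₁ contributes the whole weight, D₂ contributes nothing (D₁ ∩ D₂ is a single point).
        weight-equation : m * ΣL Bs weight ≡ ΣL Bs weight + ΣL 𝒟 (λ D → other D * inside D)
        weight-equation = begin
          m * ΣL Bs weight                                                ≡⟨ double-count ⟩
          ΣL 𝒟 inside                                                     ≡⟨ split-family inside ⟩
          inside D₁ + inside D₂ + ΣL 𝒟 (λ D → other D * inside D)         ≡⟨ cong (_+ ΣL 𝒟 (λ D → other D * inside D))
                                                                               (trans (cong₂ _+_ inside-D₁ inside-D₂) (+-identityʳ _)) ⟩
          ΣL Bs weight + ΣL 𝒟 (λ D → other D * inside D)                  ∎
          where
          open ≡-Reasoning
          inside-D₂ : inside D₂ ≡ 0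
          inside-D₂ = inside-small D₂ (≤-reflexive (trans (cong ∣_∣ (∩-comm D₂ D₁)) one-point))

      p∈-block : ∀ {D B₀} → D ∩ D₁ ≡ B₀ → ind (p ∈? D) ≡ ind (p ∈? B₀)
      p∈-block {D} {B₀} D∩D₁≡B₀ = ind-⇔ (p ∈? D) (p ∈? B₀) (λ p∈D → subst (p ∈_) D∩D₁≡B₀ (x∈p∩q⁺ (p∈D , p∈D₁)))
                                                           (λ p∈B₀ → p∩q⊆p D D₁ (subst (p ∈_) (sym D∩D₁≡B₀) p∈B₀))

      inD₁-pattern : ∀ {D a} → patternOf D ≡ shape j a → ∣ D ∩ D₁ ∣ ≡ inD₁ j a
      inD₁-pattern {D} pattern≡ = trans (sym (left+middle D)) (cong (λ P → proj₁ P + proj₁ (proj₂ P)) pattern≡)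

      blocksAvoiding blocksThrough : ℕ
      blocksAvoiding = ΣL Bs (λ B → ind (B ⊆? D₁) * ind (¬? (p ∈? B)))
      blocksThrough = degreeIn D₁ p

      avoiding-count : m * blocksAvoiding ≡ blocksAvoiding + ΣF 13 (λ i → avoid i * N i)
      avoiding-count = trans weight-equation (cong (blocksAvoiding +_) (sum-by-pattern inside avoid byPattern))
        where
        open BlockWeights (λ B → ind (¬? (p ∈? B)))
        byPattern : ∀ {D} a → D ∈L 𝒟 → D ≢ D₁ → D ≢ D₂ → patternOf D ≡ shape j a → inside D ≡ avoid a
        byPattern {D} a D∈ D≢D₁ _ pattern≡ with meet D∈ D₁∈ D≢D₁
        ... | inj₁ ≤1 = trans (inside-small D ≤1) (sym (proj₁ (weights-small j a (subst (_≤ 1) (inD₁-pattern {D} pattern≡) ≤1))))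
        ... | inj₂ (B₀ , B₀∈ , D∩D₁≡B₀) = trans (inside-block D B₀ B₀∈ D∩D₁≡B₀) (+-cancelʳ-≡ _ _ _ (begin
          ind (¬? (p ∈? B₀)) + proj₁ (proj₂ (shape j a)) ≡⟨ cong (ind (¬? (p ∈? B₀)) +_) (trans (cong (λ P → proj₁ (proj₂ P)) (sym pattern≡))
                                                                                             (trans (middle-p D) (p∈-block {D} D∩D₁≡B₀))) ⟩
          ind (¬? (p ∈? B₀)) + ind (p ∈? B₀)             ≡⟨ trans (+-comm (ind (¬? (p ∈? B₀))) (ind (p ∈? B₀))) (ind-¬ (p ∈? B₀)) ⟩
          1                                              ≡⟨ sym (proj₁ (weights-block j a (trans (sym (inD₁-pattern {D} pattern≡)) (trans (cong ∣_∣ D∩D₁≡B₀) (blockSize B₀ B₀∈))))) ⟩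
          avoid a + proj₁ (proj₂ (shape j a))           ∎))
          where open ≡-Reasoning

      through-count : m * blocksThrough ≡ blocksThrough + ΣF 13 (λ i → through i * N i)
      through-count = trans weight-equation (cong (blocksThrough +_) (sum-by-pattern inside through byPattern))
        where
        open BlockWeights (λ B → ind (p ∈? B))
        byPattern : ∀ {D} a → D ∈L 𝒟 → D ≢ D₁ → D ≢ D₂ → patternOf D ≡ shape j a → inside D ≡ through a
        byPattern {D} a D∈ D≢D₁ _ pattern≡ with meet D∈ D₁∈ D≢D₁
        ... | inj₁ ≤1 = trans (inside-small D ≤1) (sym (proj₂ (weights-small j a (subst (_≤ 1) (inD₁-pattern {D} pattern≡) ≤1))))
        ... | inj₂ (B₀ , B₀∈ , D∩D₁≡B₀) = begin
          inside D                      ≡⟨ inside-block D B₀ B₀∈ D∩D₁≡B₀ ⟩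
          ind (p ∈? B₀)                 ≡⟨ sym (trans (middle-p D) (p∈-block {D} D∩D₁≡B₀)) ⟩
          middle D                      ≡⟨ cong (λ P → proj₁ (proj₂ P)) pattern≡ ⟩
          proj₁ (proj₂ (shape j a))     ≡⟨ sym (proj₂ (weights-block j a (trans (sym (inD₁-pattern {D} pattern≡)) (trans (cong ∣_∣ D∩D₁≡B₀) (blockSize B₀ B₀∈))))) ⟩
          through a                     ∎
          where open ≡-Reasoning

      -- r (k - 1) = v' - 1: the blocks of D₁ through p partition D₁ ∖ {p}.
      blocksThrough-eq : blocksThrough * suc j ≡ w
      blocksThrough-eq = suc-injective (trans (replication (closed D₁∈) p∈D₁) (size D₁ D₁∈))

      -- (c + r) k (k - 1) = v' (v' - 1): c + r is the number of blocks of D₁.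
      blocksOfD₁-eq : (blocksAvoiding + blocksThrough) * (k * suc j) ≡ suc w * w
      blocksOfD₁-eq = trans (cong (_* (k * suc j)) (sym all-blocks)) (blocksIn-minimal D₁∈)
        where
        all-blocks : blocksIn D₁ ≡ blocksAvoiding + blocksThrough
        all-blocks = trans (ΣL-cong Bs (λ B _ → split B)) (ΣL-+ Bs _ _)
          where
          split : ∀ B → ind (B ⊆? D₁) ≡ ind (B ⊆? D₁) * ind (¬? (p ∈? B)) + ind (B ⊆? D₁) * ind (p ∈? B)
          split B = sym (trans (sym (*-distribˡ-+ (ind (B ⊆? D₁)) _ _))
                               (trans (cong (ind (B ⊆? D₁) *_) (trans (+-comm (ind (¬? (p ∈? B))) (ind (p ∈? B))) (ind-¬ (p ∈? B)))) (*-identityʳ _)))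

      module PointCount (l : ℕ) (point-l : ∀ x → pointCount 𝒟 x ≡ l) where
        memberships : ∀ x → ΣL 𝒟 (λ D → ind (x ∈? D)) ≡ l
        memberships x = trans (sym (length-filter (x ∈?_) 𝒟)) (point-l x)

        -- Counting pairs (x, D) with x ∈ (D₁ ∖ D₂) ∩ D: w · l = w + Σᵢ x₁ Nᵢ.
        left-points : w * l ≡ w + ΣF 13 (λ i → proj₁ (shape j i) * N i)
        left-points = begin
          w * l                                             ≡⟨ cong (_* l) (trans (sym |D₁─D₂|) (card (D₁ ─ D₂))) ⟩
          ΣF v (λ x → ind (x ∈? D₁ ─ D₂)) * l               ≡⟨ sym (ΣL-*ʳ (allFin v) l _) ⟩
          ΣF v (λ x → ind (x ∈? D₁ ─ D₂) * l)               ≡⟨ ΣF-cong v (λ x → cong (ind (x ∈? D₁ ─ D₂) *_) (sym (memberships x))) ⟩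
          ΣF v (λ x → ind (x ∈? D₁ ─ D₂) * ΣL 𝒟 (λ D → ind (x ∈? D))) ≡⟨ ΣF-cong v (λ x → sym (ΣL-*ˡ 𝒟 (ind (x ∈? D₁ ─ D₂)) (λ D → ind (x ∈? D)))) ⟩
          ΣF v (λ x → ΣL 𝒟 (λ D → ind (x ∈? D₁ ─ D₂) * ind (x ∈? D))) ≡⟨ ΣL-swap (allFin v) 𝒟 _ ⟩
          ΣL 𝒟 (λ D → ΣF v (λ x → ind (x ∈? D₁ ─ D₂) * ind (x ∈? D))) ≡⟨ ΣL-cong 𝒟 (λ D _ → sym (trans (cong ∣_∣ (∩-comm D (D₁ ─ D₂))) (card-∩ (D₁ ─ D₂) D))) ⟩
          ΣL 𝒟 left                                         ≡⟨ split-family left ⟩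
          left D₁ + left D₂ + ΣL 𝒟 (λ D → other D * left D) ≡⟨ cong₂ _+_ (trans (cong₂ _+_ left-D₁ left-D₂) (+-identityʳ w))
                                                                  (sum-by-pattern left (λ i → proj₁ (shape j i)) (λ a _ _ _ pattern≡ → cong proj₁ pattern≡)) ⟩
          w + ΣF 13 (λ i → proj₁ (shape j i) * N i)         ∎
          where open ≡-Reasoning

        at-p : l ≡ 2 + ΣF 13 (λ i → proj₁ (proj₂ (shape j i)) * N i)
        at-p = begin
          l                                                 ≡⟨ sym (memberships p) ⟩
          ΣL 𝒟 (λ D → ind (p ∈? D))                         ≡⟨ split-family (λ D → ind (p ∈? D)) ⟩
          ind (p ∈? D₁) + ind (p ∈? D₂) + ΣL 𝒟 (λ D → other D * ind (p ∈? D))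
            ≡⟨ cong₂ _+_ (cong₂ _+_ (ind-yes (p ∈? D₁) p∈D₁) (ind-yes (p ∈? D₂) p∈D₂))
                         (sum-by-pattern (λ D → ind (p ∈? D)) (λ i → proj₁ (proj₂ (shape j i)))
                                         (λ {D} a _ _ _ pattern≡ → trans (sym (middle-p D)) (cong (λ P → proj₁ (proj₂ P)) pattern≡))) ⟩
          2 + ΣF 13 (λ i → proj₁ (proj₂ (shape j i)) * N i) ∎
          where open ≡-Reasoning

module LinearAlgebra where
  open import Data.Rational using (ℚ; _+_; _-_; _*_; 0ℚ; 1ℚ; -_; 1/_; ≢-nonZero)
  import Data.Rational.Properties as ℚP
  open import Relation.Binary.PropositionalEquality
  open import Relation.Nullary using (yes; no)
  open import Data.Empty using (⊥-elim)
  open import Data.Product using (_×_; _,_)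
  open import Data.Maybe using (Maybe; just; nothing)
  open import Data.List using (_∷_; [])
  open import Tactic.RingSolver using (solve)
  open import Tactic.RingSolver.Core.AlmostCommutativeRing using (AlmostCommutativeRing; fromCommutativeRing)
  open import Defs using (_÷'_)

  ℚ-ring : AlmostCommutativeRing _ _
  ℚ-ring = fromCommutativeRing ℚP.+-*-commutativeRing isZero
    where
    isZero : (x : ℚ) → Maybe (0ℚ ≡ x)
    isZero x with 0ℚ ℚP.≟ x
    ... | yes 0≡x = just 0≡x
    ... | no _ = nothing

  -- To derive lhs ≡ rhs from l ≡ r, show lhs ≡ rhs + c (l - r) as a polynomial identity.
  combine : ∀ {lhs rhs l r : ℚ} (c : ℚ) → l ≡ r → lhs ≡ rhs + c * (l - r) → lhs ≡ rhs
  combine {lhs} {rhs} {l} c refl eq = begin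
    lhs                 ≡⟨ eq ⟩
    rhs + c * (l - l)   ≡⟨ cong (λ z → rhs + c * z) (ℚP.+-inverseʳ l) ⟩
    rhs + c * 0ℚ        ≡⟨ cong (rhs +_) (ℚP.*-zeroʳ c) ⟩
    rhs + 0ℚ            ≡⟨ ℚP.+-identityʳ rhs ⟩
    rhs                 ∎
    where open ≡-Reasoning

  *-cancelʳ : ∀ {X Z} Y → Y ≢ 0ℚ → X * Y ≡ Z * Y → X ≡ Z
  *-cancelʳ {X} {Z} Y Y≢0 eq = begin
    X                   ≡⟨ sym (ℚP.*-identityʳ X) ⟩
    X * 1ℚ              ≡⟨ cong (X *_) (sym (ℚP.*-inverseʳ Y)) ⟩
    X * (Y * (1/ Y))    ≡⟨ sym (ℚP.*-assoc X Y (1/ Y)) ⟩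
    X * Y * (1/ Y)      ≡⟨ cong (_* (1/ Y)) eq ⟩
    Z * Y * (1/ Y)      ≡⟨ ℚP.*-assoc Z Y (1/ Y) ⟩
    Z * (Y * (1/ Y))    ≡⟨ cong (Z *_) (ℚP.*-inverseʳ Y) ⟩
    Z * 1ℚ              ≡⟨ ℚP.*-identityʳ Z ⟩
    Z                   ∎
    where
    open ≡-Reasoning
    instance _ = ≢-nonZero Y≢0

  *-≢0 : ∀ {X Y} → X ≢ 0ℚ → Y ≢ 0ℚ → X * Y ≢ 0ℚ
  *-≢0 {X} {Y} X≢0 Y≢0 XY≡0 = X≢0 (*-cancelʳ Y Y≢0 (trans XY≡0 (sym (ℚP.*-zeroˡ Y))))

  ÷'-inverse : ∀ X Y → Y ≢ 0ℚ → (X ÷' Y) * Y ≡ X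
  ÷'-inverse X Y Y≢0 with Y ℚP.≟ 0ℚ
  ... | yes Y≡0 = ⊥-elim (Y≢0 Y≡0)
  ... | no Y≢0′ = trans (ℚP.*-assoc X (1/ Y) Y) (trans (cong (X *_) (ℚP.*-inverseˡ Y)) (ℚP.*-identityʳ X))
    where instance _ = ≢-nonZero Y≢0′

  ÷'-unique : ∀ X Y Z → Y ≢ 0ℚ → Z * Y ≡ X → X ÷' Y ≡ Z
  ÷'-unique X Y Z Y≢0 eq = *-cancelʳ Y Y≢0 (trans (÷'-inverse X Y Y≢0) (sym eq))

  two : ℚ
  two = 1ℚ + 1ℚ

  -- The counting relations, in the unknowns a₁, …, a₁₃ (the numbers of members of each
  -- pattern), together with the auxiliary quantities L = l, Fam = |𝒟|, Cᵢ = c, Rᵢ = r of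
  -- the pair (D₁, D₂) and of the swapped pair (D₂, D₁).
  module Relations (K W V M L Fam C₁ R₁ C₂ R₂ a₁ a₂ a₃ a₄ a₅ a₆ a₇ a₈ a₉ a₁₀ a₁₁ a₁₂ a₁₃ : ℚ) where
    record Equations : Set where
      field
        K-1≢0 : K - 1ℚ ≢ 0ℚ
        W-1≢0 : W - 1ℚ ≢ 0ℚ
        K≢0 : K ≢ 0ℚ
        W≢0 : W ≢ 0ℚ
        through-p₁ : R₁ * (K - 1ℚ) ≡ W - 1ℚ
        through-p₂ : R₂ * (K - 1ℚ) ≡ W - 1ℚ
        blocks₁ : (C₁ + R₁) * (K * (K - 1ℚ)) ≡ W * (W - 1ℚ)
        blocks₂ : (C₂ + R₂) * (K * (K - 1ℚ)) ≡ W * (W - 1ℚ)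
        avoiding₁ : a₁ + a₃ + a₅ + C₁ ≡ M * C₁
        avoiding₂ : a₁ + a₄ + a₆ + C₂ ≡ M * C₂
        through₁ : a₂ + a₇ + R₁ ≡ M * R₁
        through₂ : a₂ + a₈ + R₂ ≡ M * R₂
        crossing : K * K * a₁ + (K - 1ℚ) * (K - 1ℚ) * a₂ + K * a₃ + K * a₄ + a₉ ≡ M * ((W - 1ℚ) * (W - 1ℚ))
        left₁ : K * (a₁ + a₃ + a₅) + (K - 1ℚ) * (a₂ + a₇) + a₄ + a₉ + a₁₀ + (W - 1ℚ) ≡ (W - 1ℚ) * L
        left₂ : K * (a₁ + a₄ + a₆) + (K - 1ℚ) * (a₂ + a₈) + a₃ + a₉ + a₁₁ + (W - 1ℚ) ≡ (W - 1ℚ) * L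
        at-p : two + a₂ + a₇ + a₈ + a₁₂ ≡ L
        point : L * (W - 1ℚ) ≡ M * (V - 1ℚ)
        family : two + (a₁ + a₂ + a₃ + a₄ + a₅ + a₆ + a₇ + a₈ + a₉ + a₁₀ + a₁₁ + a₁₂ + a₁₃) ≡ Fam
        family-size : Fam * (W * (W - 1ℚ)) ≡ M * (V * (V - 1ℚ))

    Conclusion : Set
    Conclusion =
        (a₅ ≡ (M - 1ℚ) * (W - 1ℚ) * (W - K) ÷' (K * (K - 1ℚ)) - a₁ - a₃)
      × (a₆ ≡ (M - 1ℚ) * (W - 1ℚ) * (W - K) ÷' (K * (K - 1ℚ)) - a₁ - a₄)
      × (a₇ ≡ (M - 1ℚ) * (W - 1ℚ) ÷' (K - 1ℚ) - a₂)
      × (a₈ ≡ (M - 1ℚ) * (W - 1ℚ) ÷' (K - 1ℚ) - a₂)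
      × (a₉ ≡ M * ((W - 1ℚ) * (W - 1ℚ)) - K * K * a₁ - (K - 1ℚ) * (K - 1ℚ) * a₂ - K * a₃ - K * a₄)
      × (a₁₀ ≡ M * (V - 1ℚ - K * ((W - 1ℚ) * (W - 1ℚ)) ÷' (K - 1ℚ)) + (W - 1ℚ) * (W - K) ÷' (K - 1ℚ)
               + K * K * a₁ + (K - 1ℚ) * (K - 1ℚ) * a₂ + K * a₃ + (K - 1ℚ) * a₄)
      × (a₁₁ ≡ M * (V - 1ℚ - K * ((W - 1ℚ) * (W - 1ℚ)) ÷' (K - 1ℚ)) + (W - 1ℚ) * (W - K) ÷' (K - 1ℚ)
               + K * K * a₁ + (K - 1ℚ) * (K - 1ℚ) * a₂ + (K - 1ℚ) * a₃ + K * a₄)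
      × (a₁₂ ≡ M * ((V - 1ℚ) ÷' (W - 1ℚ) - two * (W - 1ℚ) ÷' (K - 1ℚ)) + two * (W - K) ÷' (K - 1ℚ) + a₂)
      × (a₁₃ ≡ M * (V * (V - 1ℚ) ÷' (W * (W - 1ℚ)) + (W - 1ℚ) * (W - 1ℚ) + (V - 1ℚ) ÷' (W - 1ℚ)
                    - two * W * ((V - 1ℚ) ÷' (W - 1ℚ) - (W - 1ℚ) ÷' K))
               - two * (W - 1ℚ) * (W - K) ÷' K
               - (K * K - 1ℚ) * a₁ - (K - 1ℚ) * (K - 1ℚ) * a₂ - (K - 1ℚ) * a₃ - (K - 1ℚ) * a₄)

    module Solve (eqs : Equations) where
      open Equations eqs

      R₂≡R₁ : R₂ ≡ R₁
      R₂≡R₁ = *-cancelʳ (K - 1ℚ) K-1≢0 (trans through-p₂ (sym through-p₁))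

      C₂≡C₁ : C₂ ≡ C₁
      C₂≡C₁ = combine 1ℚ (sym R₂≡R₁) (combine 1ℚ sum≡ (solve (C₁ ∷ C₂ ∷ R₁ ∷ R₂ ∷ []) ℚ-ring))
        where
        sum≡ : C₂ + R₂ ≡ C₁ + R₁
        sum≡ = *-cancelʳ (K * (K - 1ℚ)) (*-≢0 K≢0 K-1≢0) (trans blocks₂ (sym blocks₁))

      avoiding₂′ : a₁ + a₄ + a₆ + C₁ ≡ M * C₁
      avoiding₂′ = subst (λ C → a₁ + a₄ + a₆ + C ≡ M * C) C₂≡C₁ avoiding₂

      through₂′ : a₂ + a₈ + R₁ ≡ M * R₁
      through₂′ = subst (λ R → a₂ + a₈ + R ≡ M * R) R₂≡R₁ through₂

      C₁-from-R₁ : K * C₁ ≡ (W - 1ℚ) * R₁ - (W - 1ℚ)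
      C₁-from-R₁ = *-cancelʳ (K - 1ℚ) K-1≢0
        (combine (- (K + (W - 1ℚ))) through-p₁ (combine 1ℚ blocks₁ (solve (K ∷ W ∷ C₁ ∷ R₁ ∷ []) ℚ-ring)))

      quotient-c : (M - 1ℚ) * (W - 1ℚ) * (W - K) ÷' (K * (K - 1ℚ)) ≡ (M - 1ℚ) * C₁
      quotient-c = ÷'-unique _ _ _ (*-≢0 K≢0 K-1≢0)
        (combine (- ((M - 1ℚ) * K)) through-p₁ (combine (M - 1ℚ) blocks₁ (solve (K ∷ W ∷ M ∷ C₁ ∷ R₁ ∷ []) ℚ-ring)))

      quotient-r : (M - 1ℚ) * (W - 1ℚ) ÷' (K - 1ℚ) ≡ (M - 1ℚ) * R₁
      quotient-r = ÷'-unique _ _ _ K-1≢0 (combine (M - 1ℚ) through-p₁ (solve (K ∷ W ∷ M ∷ R₁ ∷ []) ℚ-ring))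

      quotient-kw² : K * ((W - 1ℚ) * (W - 1ℚ)) ÷' (K - 1ℚ) ≡ K * (W - 1ℚ) * R₁
      quotient-kw² = ÷'-unique _ _ _ K-1≢0 (combine (K * (W - 1ℚ)) through-p₁ (solve (K ∷ W ∷ R₁ ∷ []) ℚ-ring))

      quotient-ww : (W - 1ℚ) * (W - K) ÷' (K - 1ℚ) ≡ (W - 1ℚ) * R₁ - (W - 1ℚ)
      quotient-ww = ÷'-unique _ _ _ K-1≢0 (combine (W - 1ℚ) through-p₁ (solve (K ∷ W ∷ R₁ ∷ []) ℚ-ring))

      quotient-2r : two * (W - 1ℚ) ÷' (K - 1ℚ) ≡ two * R₁
      quotient-2r = ÷'-unique _ _ _ K-1≢0 (combine two through-p₁ (solve (K ∷ W ∷ R₁ ∷ []) ℚ-ring))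

      quotient-2r-2 : two * (W - K) ÷' (K - 1ℚ) ≡ two * R₁ - two
      quotient-2r-2 = ÷'-unique _ _ _ K-1≢0 (combine two through-p₁ (solve (K ∷ W ∷ R₁ ∷ []) ℚ-ring))

      quotient-2b : two * (W - 1ℚ) * (W - K) ÷' K ≡ two * (C₁ + R₁) * (K - 1ℚ) - two * (W - 1ℚ)
      quotient-2b = ÷'-unique _ _ _ K≢0 (combine two blocks₁ (solve (K ∷ W ∷ C₁ ∷ R₁ ∷ []) ℚ-ring))

      m-quotient-L : ∀ Q → Q * (W - 1ℚ) ≡ V - 1ℚ → M * Q ≡ L
      m-quotient-L Q eq = *-cancelʳ (W - 1ℚ) W-1≢0 (combine (- 1ℚ) point (combine M eq (solve (W ∷ V ∷ M ∷ L ∷ Q ∷ []) ℚ-ring)))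

      m-quotient-Fam : ∀ Q → Q * (W * (W - 1ℚ)) ≡ V * (V - 1ℚ) → M * Q ≡ Fam
      m-quotient-Fam Q eq = *-cancelʳ (W * (W - 1ℚ)) (*-≢0 W≢0 W-1≢0)
        (combine (- 1ℚ) family-size (combine M eq (solve (W ∷ V ∷ M ∷ Fam ∷ Q ∷ []) ℚ-ring)))

      w-quotient-K : ∀ Q → Q * K ≡ W - 1ℚ → W * Q ≡ (C₁ + R₁) * (K - 1ℚ)
      w-quotient-K Q eq = *-cancelʳ K K≢0 (combine (- 1ℚ) blocks₁ (combine W eq (solve (K ∷ W ∷ C₁ ∷ R₁ ∷ Q ∷ []) ℚ-ring)))

      a₅-eq : a₅ ≡ (M - 1ℚ) * C₁ - a₁ - a₃
      a₅-eq = combine 1ℚ avoiding₁ (solve (M ∷ C₁ ∷ a₁ ∷ a₃ ∷ a₅ ∷ []) ℚ-ring)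

      a₆-eq : a₆ ≡ (M - 1ℚ) * C₁ - a₁ - a₄
      a₆-eq = combine 1ℚ avoiding₂′ (solve (M ∷ C₁ ∷ a₁ ∷ a₄ ∷ a₆ ∷ []) ℚ-ring)

      a₇-eq : a₇ ≡ (M - 1ℚ) * R₁ - a₂
      a₇-eq = combine 1ℚ through₁ (solve (M ∷ R₁ ∷ a₂ ∷ a₇ ∷ []) ℚ-ring)

      a₈-eq : a₈ ≡ (M - 1ℚ) * R₁ - a₂
      a₈-eq = combine 1ℚ through₂′ (solve (M ∷ R₁ ∷ a₂ ∷ a₈ ∷ []) ℚ-ring)

      a₉-eq : a₉ ≡ M * ((W - 1ℚ) * (W - 1ℚ)) - K * K * a₁ - (K - 1ℚ) * (K - 1ℚ) * a₂ - K * a₃ - K * a₄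
      a₉-eq = combine 1ℚ crossing (solve (K ∷ W ∷ M ∷ a₁ ∷ a₂ ∷ a₃ ∷ a₄ ∷ a₉ ∷ []) ℚ-ring)

      a₁₀-eq : a₁₀ ≡ M * (V - 1ℚ - K * (W - 1ℚ) * R₁) + ((W - 1ℚ) * R₁ - (W - 1ℚ))
                     + K * K * a₁ + (K - 1ℚ) * (K - 1ℚ) * a₂ + K * a₃ + (K - 1ℚ) * a₄
      a₁₀-eq =
        combine (M * (W - 1ℚ) - M + 1ℚ) through-p₁ (combine (- (M - 1ℚ)) C₁-from-R₁ (combine 1ℚ point (combine (- 1ℚ) crossing
          (combine (- (K - 1ℚ)) through₁ (combine (- K) avoiding₁ (combine 1ℚ left₁
            (solve (K ∷ W ∷ V ∷ M ∷ L ∷ C₁ ∷ R₁ ∷ a₁ ∷ a₂ ∷ a₃ ∷ a₄ ∷ a₅ ∷ a₇ ∷ a₉ ∷ a₁₀ ∷ []) ℚ-ring)))))))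

      a₁₁-eq : a₁₁ ≡ M * (V - 1ℚ - K * (W - 1ℚ) * R₁) + ((W - 1ℚ) * R₁ - (W - 1ℚ))
                     + K * K * a₁ + (K - 1ℚ) * (K - 1ℚ) * a₂ + (K - 1ℚ) * a₃ + K * a₄
      a₁₁-eq =
        combine (M * (W - 1ℚ) - M + 1ℚ) through-p₁ (combine (- (M - 1ℚ)) C₁-from-R₁ (combine 1ℚ point (combine (- 1ℚ) crossing
          (combine (- (K - 1ℚ)) through₂′ (combine (- K) avoiding₂′ (combine 1ℚ left₂
            (solve (K ∷ W ∷ V ∷ M ∷ L ∷ C₁ ∷ R₁ ∷ a₁ ∷ a₂ ∷ a₃ ∷ a₄ ∷ a₆ ∷ a₈ ∷ a₉ ∷ a₁₁ ∷ []) ℚ-ring)))))))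

      a₁₂-eq : ∀ Q → M * Q ≡ L → a₁₂ ≡ M * (Q - two * R₁) + (two * R₁ - two) + a₂
      a₁₂-eq Q mQ = combine (- 1ℚ) mQ (combine (- 1ℚ) through₂′ (combine (- 1ℚ) through₁ (combine 1ℚ at-p
        (solve (M ∷ L ∷ R₁ ∷ a₂ ∷ a₇ ∷ a₈ ∷ a₁₂ ∷ Q ∷ []) ℚ-ring))))

      a₁₃-eq : ∀ Q₀ Q₁ Q₂ → M * Q₀ ≡ Fam → M * Q₁ ≡ L → Q₁ * (W - 1ℚ) ≡ V - 1ℚ → W * Q₂ ≡ (C₁ + R₁) * (K - 1ℚ) →
               a₁₃ ≡ M * (Q₀ + (W - 1ℚ) * (W - 1ℚ) + Q₁ - two * W * (Q₁ - Q₂))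
                     - (two * (C₁ + R₁) * (K - 1ℚ) - two * (W - 1ℚ))
                     - (K * K - 1ℚ) * a₁ - (K - 1ℚ) * (K - 1ℚ) * a₂ - (K - 1ℚ) * a₃ - (K - 1ℚ) * a₄
      a₁₃-eq Q₀ Q₁ Q₂ mQ₀ mQ₁ Q₁-eq wQ₂ =
        combine (- (two * (M - 1ℚ))) C₁-from-R₁ (combine (two * M * (W - 1ℚ) - two * (M - 1ℚ)) through-p₁
        (combine (- (two * M)) wQ₂ (combine (two * M) Q₁-eq (combine (- 1ℚ) mQ₀
        (combine (- 1ℚ) a₅-eq (combine (- 1ℚ) a₆-eq (combine (- 1ℚ) a₇-eq (combine (- 1ℚ) a₈-eq (combine (- 1ℚ) a₉-eq
        (combine (- 1ℚ) a₁₀-eq (combine (- 1ℚ) a₁₁-eq (combine (- 1ℚ) (a₁₂-eq Q₁ mQ₁) (combine 1ℚ family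
        (solve (K ∷ W ∷ V ∷ M ∷ L ∷ Fam ∷ C₁ ∷ R₁ ∷ a₁ ∷ a₂ ∷ a₃ ∷ a₄ ∷ a₅ ∷ a₆ ∷ a₇ ∷ a₈ ∷ a₉ ∷ a₁₀ ∷ a₁₁ ∷ a₁₂ ∷ a₁₃ ∷ Q₀ ∷ Q₁ ∷ Q₂ ∷ [])
               ℚ-ring))))))))))))))

    solution : Equations → Conclusion
    solution eqs =
        trans a₅-eq (cong (λ z → z - a₁ - a₃) (sym quotient-c))
      , trans a₆-eq (cong (λ z → z - a₁ - a₄) (sym quotient-c))
      , trans a₇-eq (cong (_- a₂) (sym quotient-r))
      , trans a₈-eq (cong (_- a₂) (sym quotient-r))
      , a₉-eq
      , trans a₁₀-eq (cong₂ (λ x y → M * (V - 1ℚ - x) + y + K * K * a₁ + (K - 1ℚ) * (K - 1ℚ) * a₂ + K * a₃ + (K - 1ℚ) * a₄)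
                            (sym quotient-kw²) (sym quotient-ww))
      , trans a₁₁-eq (cong₂ (λ x y → M * (V - 1ℚ - x) + y + K * K * a₁ + (K - 1ℚ) * (K - 1ℚ) * a₂ + (K - 1ℚ) * a₃ + K * a₄)
                            (sym quotient-kw²) (sym quotient-ww))
      , trans (a₁₂-eq Q₁ mQ₁) (cong₂ (λ x y → M * (Q₁ - x) + y + a₂) (sym quotient-2r) (sym quotient-2r-2))
      , trans (a₁₃-eq Q₀ Q₁ Q₂ mQ₀ mQ₁ Q₁-eq wQ₂)
              (cong (λ z → M * (Q₀ + (W - 1ℚ) * (W - 1ℚ) + Q₁ - two * W * (Q₁ - Q₂)) - z
                           - (K * K - 1ℚ) * a₁ - (K - 1ℚ) * (K - 1ℚ) * a₂ - (K - 1ℚ) * a₃ - (K - 1ℚ) * a₄)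
                    (sym quotient-2b))
      where
      open Solve eqs
      open Equations eqs
      Q₀ Q₁ Q₂ : ℚ
      Q₀ = V * (V - 1ℚ) ÷' (W * (W - 1ℚ))
      Q₁ = (V - 1ℚ) ÷' (W - 1ℚ)
      Q₂ = (W - 1ℚ) ÷' K
      Q₁-eq : Q₁ * (W - 1ℚ) ≡ V - 1ℚ
      Q₁-eq = ÷'-inverse _ _ W-1≢0
      mQ₀ : M * Q₀ ≡ Fam
      mQ₀ = m-quotient-Fam Q₀ (÷'-inverse _ _ (*-≢0 W≢0 W-1≢0))
      mQ₁ : M * Q₁ ≡ L
      mQ₁ = m-quotient-L Q₁ Q₁-eq
      wQ₂ : W * Q₂ ≡ (C₁ + R₁) * (K - 1ℚ)
      wQ₂ = w-quotient-K Q₂ (÷'-inverse _ _ K≢0)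

-- The embedding ι : ℕ → ℚ is a semiring homomorphism; equations between ℕ-expressions
-- transfer to ℚ by evaluating expression trees in both.
module Embedding where
  open import Data.Nat as ℕ using (ℕ; suc; zero)
  open import Data.Integer as ℤ using (+_)
  import Data.Integer.Properties as ℤP
  open import Data.Rational using (ℚ; _+_; _-_; _*_; 0ℚ; 1ℚ; mkℚ)
  import Data.Rational.Unnormalised as ℚᵘ
  import Data.Rational.Unnormalised.Properties as ℚᵘP
  import Data.Rational.Properties as ℚP
  open import Data.Nat.Coprimality using (1-coprimeTo) renaming (sym to coprime-sym)
  open import Relation.Binary.PropositionalEquality
  open import Data.Empty using (⊥-elim)
  open import Tactic.RingSolver using (solve-∀)
  open import Defs using (ι)
  open LinearAlgebra using (ℚ-ring)

  ι′ : ℕ → ℚ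
  ι′ n = mkℚ (+ n) 0 (coprime-sym (1-coprimeTo n))

  ι-normal : ∀ n → ι n ≡ ι′ n
  ι-normal n = ℚP.↥p/↧p≡p (ι′ n)

  ι-+ : ∀ a b → ι (a ℕ.+ b) ≡ ι a + ι b
  ι-+ a b rewrite ι-normal (a ℕ.+ b) | ι-normal a | ι-normal b =
    ℚP.toℚᵘ-injective (ℚᵘP.≃-trans (ℚᵘ.*≡* eq) (ℚᵘP.≃-sym (ℚP.toℚᵘ-homo-+ (ι′ a) (ι′ b))))
    where
    eq : + (a ℕ.+ b) ℤ.* + 1 ≡ (+ a ℤ.* + 1 ℤ.+ + b ℤ.* + 1) ℤ.* + 1
    eq = trans (ℤP.*-identityʳ _) (trans (ℤP.pos-+ a b)
           (sym (trans (ℤP.*-identityʳ _) (cong₂ ℤ._+_ (ℤP.*-identityʳ (+ a)) (ℤP.*-identityʳ (+ b))))))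

  ι-* : ∀ a b → ι (a ℕ.* b) ≡ ι a * ι b
  ι-* a b rewrite ι-normal (a ℕ.* b) | ι-normal a | ι-normal b =
    ℚP.toℚᵘ-injective (ℚᵘP.≃-trans (ℚᵘ.*≡* eq) (ℚᵘP.≃-sym (ℚP.toℚᵘ-homo-* (ι′ a) (ι′ b))))
    where
    eq : + (a ℕ.* b) ℤ.* + 1 ≡ (+ a ℤ.* + b) ℤ.* + 1
    eq = trans (ℤP.*-identityʳ _) (trans (ℤP.pos-* a b) (sym (ℤP.*-identityʳ _)))

  ι-suc≢0 : ∀ n → ι (suc n) ≢ 0ℚ
  ι-suc≢0 n eq with trans (sym (ι-normal (suc n))) eq
  ... | ()

  ι≢0 : ∀ n → n ≢ 0 → ι n ≢ 0ℚ
  ι≢0 zero n≢0 = ⊥-elim (n≢0 refl)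
  ι≢0 (suc n) _ = ι-suc≢0 n

  ι-suc-1 : ∀ n → ι (suc n) - 1ℚ ≡ ι n
  ι-suc-1 n = trans (cong (_- 1ℚ) (ι-+ 1 n)) (cancel (ι n))
    where
    cancel : ∀ x → (1ℚ + x) - 1ℚ ≡ x
    cancel = solve-∀ ℚ-ring

  -- Expressions built from atoms by + and *. An atom is a natural number n
  -- together with a rational q known to equal ι n.
  infixl 6 _⊕_
  infixl 7 _⊗_
  data Expr : Set where
    atom : (n : ℕ) (q : ℚ) → q ≡ ι n → Expr
    _⊕_ _⊗_ : Expr → Expr → Expr

  ⟦_⟧ℕ : Expr → ℕ
  ⟦ atom n _ _ ⟧ℕ = n
  ⟦ e ⊕ f ⟧ℕ = ⟦ e ⟧ℕ ℕ.+ ⟦ f ⟧ℕ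
  ⟦ e ⊗ f ⟧ℕ = ⟦ e ⟧ℕ ℕ.* ⟦ f ⟧ℕ

  ⟦_⟧ℚ : Expr → ℚ
  ⟦ atom _ q _ ⟧ℚ = q
  ⟦ e ⊕ f ⟧ℚ = ⟦ e ⟧ℚ + ⟦ f ⟧ℚ
  ⟦ e ⊗ f ⟧ℚ = ⟦ e ⟧ℚ * ⟦ f ⟧ℚ

  ⟦⟧-ι : ∀ e → ⟦ e ⟧ℚ ≡ ι ⟦ e ⟧ℕ
  ⟦⟧-ι (atom n q q≡) = q≡
  ⟦⟧-ι (e ⊕ f) = trans (cong₂ _+_ (⟦⟧-ι e) (⟦⟧-ι f)) (sym (ι-+ ⟦ e ⟧ℕ ⟦ f ⟧ℕ))
  ⟦⟧-ι (e ⊗ f) = trans (cong₂ _*_ (⟦⟧-ι e) (⟦⟧-ι f)) (sym (ι-* ⟦ e ⟧ℕ ⟦ f ⟧ℕ))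

  transfer : ∀ e f → ⟦ e ⟧ℕ ≡ ⟦ f ⟧ℕ → ⟦ e ⟧ℚ ≡ ⟦ f ⟧ℚ
  transfer e f eq = trans (⟦⟧-ι e) (trans (cong ι eq) (sym (⟦⟧-ι f)))

  # : ℕ → Expr
  # n = atom n (ι n) refl

-- The pattern-weighted sums Σᵢ gᵢ nᵢ written out; 'ΣF 13' unfolds definitionally to
-- g₁ n₁ + (g₂ n₂ + (… + (g₁₃ n₁₃ + 0))), so each is a routine normalisation in ℕ.
module Expansions where
  open import Data.Nat
  open import Data.Fin using (Fin)
  open import Relation.Binary.PropositionalEquality
  open import Data.Nat.Tactic.RingSolver using (solve-∀)
  open import Data.Product using (proj₁; proj₂)
  open Sums using (ΣF)
  open Patterns

  avoid-sum : ∀ c (n : Fin 13 → ℕ) → n t₁ + n t₃ + n t₅ + c ≡ c + ΣF 13 (λ i → avoid i * n i)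
  avoid-sum c n = normalise c (n t₁) (n t₂) (n t₃) (n t₄) (n t₅) (n t₆) (n t₇) (n t₈) (n t₉) (n t₁₀) (n t₁₁) (n t₁₂) (n t₁₃)
    where
    normalise : ∀ c n₁ n₂ n₃ n₄ n₅ n₆ n₇ n₈ n₉ n₁₀ n₁₁ n₁₂ n₁₃ → n₁ + n₃ + n₅ + c ≡
      c + (1 * n₁ + (0 * n₂ + (1 * n₃ + (0 * n₄ + (1 * n₅ + (0 * n₆ + (0 * n₇ + (0 * n₈ + (0 * n₉ + (0 * n₁₀ + (0 * n₁₁ + (0 * n₁₂ + (0 * n₁₃ + 0)))))))))))))
    normalise = solve-∀

  through-sum : ∀ r (n : Fin 13 → ℕ) → n t₂ + n t₇ + r ≡ r + ΣF 13 (λ i → through i * n i)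
  through-sum r n = normalise r (n t₁) (n t₂) (n t₃) (n t₄) (n t₅) (n t₆) (n t₇) (n t₈) (n t₉) (n t₁₀) (n t₁₁) (n t₁₂) (n t₁₃)
    where
    normalise : ∀ r n₁ n₂ n₃ n₄ n₅ n₆ n₇ n₈ n₉ n₁₀ n₁₁ n₁₂ n₁₃ → n₂ + n₇ + r ≡
      r + (0 * n₁ + (1 * n₂ + (0 * n₃ + (0 * n₄ + (0 * n₅ + (0 * n₆ + (1 * n₇ + (0 * n₈ + (0 * n₉ + (0 * n₁₀ + (0 * n₁₁ + (0 * n₁₂ + (0 * n₁₃ + 0)))))))))))))
    normalise = solve-∀

  crossing-sum : ∀ j (n : Fin 13 → ℕ) →
    suc (suc j) * suc (suc j) * n t₁ + suc j * suc j * n t₂ + suc (suc j) * n t₃ + suc (suc j) * n t₄ + n t₉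
      ≡ ΣF 13 (λ i → (proj₁ (shape j i) * proj₂ (proj₂ (shape j i))) * n i)
  crossing-sum j n = normalise j (n t₁) (n t₂) (n t₃) (n t₄) (n t₅) (n t₆) (n t₇) (n t₈) (n t₉) (n t₁₀) (n t₁₁) (n t₁₂) (n t₁₃)
    where
    normalise : ∀ j n₁ n₂ n₃ n₄ n₅ n₆ n₇ n₈ n₉ n₁₀ n₁₁ n₁₂ n₁₃ →
      suc (suc j) * suc (suc j) * n₁ + suc j * suc j * n₂ + suc (suc j) * n₃ + suc (suc j) * n₄ + n₉ ≡
      (suc (suc j) * suc (suc j)) * n₁ + ((suc j * suc j) * n₂ + ((suc (suc j) * 1) * n₃ + ((1 * suc (suc j)) * n₄
      + ((suc (suc j) * 0) * n₅ + ((0 * suc (suc j)) * n₆ + ((suc j * 0) * n₇ + ((0 * suc j) * n₈ + ((1 * 1) * n₉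
      + ((1 * 0) * n₁₀ + ((0 * 1) * n₁₁ + ((0 * 0) * n₁₂ + ((0 * 0) * n₁₃ + 0))))))))))))
    normalise = solve-∀

  left-sum : ∀ j w (n : Fin 13 → ℕ) →
    suc (suc j) * (n t₁ + n t₃ + n t₅) + suc j * (n t₂ + n t₇) + n t₄ + n t₉ + n t₁₀ + w ≡ w + ΣF 13 (λ i → proj₁ (shape j i) * n i)
  left-sum j w n = normalise j w (n t₁) (n t₂) (n t₃) (n t₄) (n t₅) (n t₆) (n t₇) (n t₈) (n t₉) (n t₁₀) (n t₁₁) (n t₁₂) (n t₁₃)
    where
    normalise : ∀ j w n₁ n₂ n₃ n₄ n₅ n₆ n₇ n₈ n₉ n₁₀ n₁₁ n₁₂ n₁₃ →
      suc (suc j) * (n₁ + n₃ + n₅) + suc j * (n₂ + n₇) + n₄ + n₉ + n₁₀ + w ≡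
      w + (suc (suc j) * n₁ + (suc j * n₂ + (suc (suc j) * n₃ + (1 * n₄ + (suc (suc j) * n₅ + (0 * n₆ + (suc j * n₇
      + (0 * n₈ + (1 * n₉ + (1 * n₁₀ + (0 * n₁₁ + (0 * n₁₂ + (0 * n₁₃ + 0)))))))))))))
    normalise = solve-∀

  middle-sum : ∀ j (n : Fin 13 → ℕ) → 1 + 1 + n t₂ + n t₇ + n t₈ + n t₁₂ ≡ 2 + ΣF 13 (λ i → proj₁ (proj₂ (shape j i)) * n i)
  middle-sum j n = normalise (n t₁) (n t₂) (n t₃) (n t₄) (n t₅) (n t₆) (n t₇) (n t₈) (n t₉) (n t₁₀) (n t₁₁) (n t₁₂) (n t₁₃)
    where
    normalise : ∀ n₁ n₂ n₃ n₄ n₅ n₆ n₇ n₈ n₉ n₁₀ n₁₁ n₁₂ n₁₃ → 1 + 1 + n₂ + n₇ + n₈ + n₁₂ ≡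
      2 + (0 * n₁ + (1 * n₂ + (0 * n₃ + (0 * n₄ + (0 * n₅ + (0 * n₆ + (1 * n₇ + (1 * n₈ + (0 * n₉ + (0 * n₁₀ + (0 * n₁₁ + (1 * n₁₂ + (0 * n₁₃ + 0)))))))))))))
    normalise = solve-∀

  total-sum : ∀ (n : Fin 13 → ℕ) →
    1 + 1 + (n t₁ + n t₂ + n t₃ + n t₄ + n t₅ + n t₆ + n t₇ + n t₈ + n t₉ + n t₁₀ + n t₁₁ + n t₁₂ + n t₁₃) ≡ 2 + ΣF 13 (λ i → 1 * n i)
  total-sum n = normalise (n t₁) (n t₂) (n t₃) (n t₄) (n t₅) (n t₆) (n t₇) (n t₈) (n t₉) (n t₁₀) (n t₁₁) (n t₁₂) (n t₁₃)
    where
    normalise : ∀ n₁ n₂ n₃ n₄ n₅ n₆ n₇ n₈ n₉ n₁₀ n₁₁ n₁₂ n₁₃ →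
      1 + 1 + (n₁ + n₂ + n₃ + n₄ + n₅ + n₆ + n₇ + n₈ + n₉ + n₁₀ + n₁₁ + n₁₂ + n₁₃) ≡
      2 + (1 * n₁ + (1 * n₂ + (1 * n₃ + (1 * n₄ + (1 * n₅ + (1 * n₆ + (1 * n₇ + (1 * n₈ + (1 * n₉ + (1 * n₁₀ + (1 * n₁₁ + (1 * n₁₂ + (1 * n₁₃ + 0)))))))))))))
    normalise = solve-∀

open import Defs
open import Data.Nat using (ℕ; zero; suc; _∸_; _<_; s≤s)
import Data.Nat as ℕ
open import Data.Nat.Properties using (*-comm; n≮0; n≮n)
open import Data.Fin using (Fin)
open import Data.Fin.Subset using (Subset; ∣_∣; _∩_; ⊤)
open import Data.Fin.Subset.Properties using (∩-comm; ∈⊤; ∣⊤∣≡n)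
open import Data.List using (List; length)
open import Data.List.Membership.Propositional using () renaming (_∈_ to _∈L_)
open import Data.List.Relation.Unary.Unique.Propositional using (Unique)
open import Data.Product using (Σ; _×_; _,_; proj₁; proj₂)
open import Data.Empty using (⊥-elim)
open import Function.Bundles using (_⇔_; Equivalence)
open import Relation.Binary.PropositionalEquality
open import Data.Rational using (ℚ; _+_; _-_; _*_; 1ℚ)
open Sums using (ΣF; ΣF-cong)
open Patterns
open MinimalFamily using (Ncount-swap)
open LinearAlgebra using (module Relations)
open Embedding
open Expansions

-- Assembling the counting identities for the pair (D₁, D₂) and the swapped pair (D₂, D₁)
-- into the linear system over ℚ, for k = j + 2 and v' = w + 1.
module Assembly (v j : ℕ) (Bs : List (Subset v)) (bibd : IsBIBD v (suc (suc j)) 1 Bs)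
                (𝒟 : List (Subset v)) (𝒟-unique : Unique 𝒟)
                (𝒟-minimal : ∀ D → (D ∈L 𝒟) ⇔ IsMinimalSubBIBD (suc (suc j)) Bs D)
                (m l : ℕ) (point-l : ∀ x → pointCount 𝒟 x ≡ l)
                (block-m : ∀ B → B ∈L Bs → blockCount 𝒟 B ≡ m)
                (w : ℕ) (size : ∀ D → D ∈L 𝒟 → ∣ D ∣ ≡ suc w)
                (D₁ D₂ : Subset v) (D₁∈ : D₁ ∈L 𝒟) (D₂∈ : D₂ ∈L 𝒟) (one-point : ∣ D₁ ∩ D₂ ∣ ≡ 1) where
  open MinimalFamily.Family v j Bs bibd 𝒟 𝒟-unique 𝒟-minimal m block-m w size
  open Steiner.System v (suc j) Bs bibd using (degreeIn; replication; closed-⊤)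
  module P₁₂ = Pair D₁ D₂ D₁∈ D₂∈ one-point
  module P₂₁ = Pair D₂ D₁ D₂∈ D₁∈ (trans (cong ∣_∣ (∩-comm D₂ D₁)) one-point)
  module L₁₂ = P₁₂.PointCount l point-l
  module L₂₁ = P₂₁.PointCount l point-l

  N : Fin 13 → ℕ
  N = P₁₂.N

  mirrored : ∀ i → P₂₁.N i ≡ N (mirror i)
  mirrored i = trans (sym (Ncount-swap 𝒟 D₂ D₁ (proj₁ (shape j i)) (proj₁ (proj₂ (shape j i))) (proj₂ (proj₂ (shape j i)))))
                     (cong (λ P → Ncount 𝒟 D₁ D₂ (proj₁ P) (proj₁ (proj₂ P)) (proj₂ (proj₂ P))) (sym (shape-mirror j i)))

  mirrored-sum : ∀ (g : Fin 13 → ℕ) → ΣF 13 (λ i → g i ℕ.* P₂₁.N i) ≡ ΣF 13 (λ i → g i ℕ.* N (mirror i))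
  mirrored-sum g = ΣF-cong 13 (λ i → cong (g i ℕ.*_) (mirrored i))

  -- v = 1 + r (k - 1), r the replication number at p.
  v₁ : ℕ
  v₁ = degreeIn ⊤ P₁₂.p ℕ.* suc j

  v≡ : v ≡ suc v₁
  v≡ = sym (trans (replication closed-⊤ {P₁₂.p} ∈⊤) (∣⊤∣≡n v))

  -- v' - 1 ≠ 0, since v' > k ≥ 2.
  w≢0 : w ≢ 0
  w≢0 refl with subst (suc (suc j) <_) (size D₁ D₁∈) (proj₁ (proj₂ (minimal D₁∈)))
  ... | s≤s ()

  -- c and r for both pairs (they coincide, which the linear algebra derives).
  c₁ r₁ c₂ r₂ : ℕ
  c₁ = P₁₂.blocksAvoiding
  r₁ = P₁₂.blocksThrough
  c₂ = P₂₁.blocksAvoiding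
  r₂ = P₂₁.blocksThrough

  avoiding-mirrored : N t₁ ℕ.+ N t₄ ℕ.+ N t₆ ℕ.+ c₂ ≡ m ℕ.* c₂
  avoiding-mirrored = trans (avoid-sum c₂ (λ i → N (mirror i)))
                            (sym (trans P₂₁.avoiding-count (cong (c₂ ℕ.+_) (mirrored-sum avoid))))

  through-mirrored : N t₂ ℕ.+ N t₈ ℕ.+ r₂ ≡ m ℕ.* r₂
  through-mirrored = trans (through-sum r₂ (λ i → N (mirror i)))
                           (sym (trans P₂₁.through-count (cong (r₂ ℕ.+_) (mirrored-sum through))))

  left-mirrored : suc (suc j) ℕ.* (N t₁ ℕ.+ N t₄ ℕ.+ N t₆) ℕ.+ suc j ℕ.* (N t₂ ℕ.+ N t₈) ℕ.+ N t₃ ℕ.+ N t₉ ℕ.+ N t₁₁ ℕ.+ w ≡ w ℕ.* l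
  left-mirrored = trans (left-sum j w (λ i → N (mirror i)))
                        (sym (trans L₂₁.left-points (cong (w ℕ.+_) (mirrored-sum (λ i → proj₁ (shape j i))))))

  K W V M L Fam C₁ R₁ C₂ R₂ : ℚ
  K = ι (suc (suc j))
  W = ι (suc w)
  V = ι v
  M = ι m
  L = ι l
  Fam = ι (length 𝒟)
  C₁ = ι c₁
  R₁ = ι r₁
  C₂ = ι c₂
  R₂ = ι r₂

  a : Fin 13 → ℚ
  a i = ι (N i)

  #a : Fin 13 → Expr
  #a i = # (N i)

  #1 #K #K-1 #W #W-1 #V #V-1 : Expr
  #1 = atom 1 1ℚ refl
  #K = # (suc (suc j))
  #K-1 = atom (suc j) (K - 1ℚ) (ι-suc-1 (suc j))
  #W = # (suc w)
  #W-1 = atom w (W - 1ℚ) (ι-suc-1 w)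
  #V = # v
  #V-1 = atom v₁ (V - 1ℚ) (trans (cong (λ n → ι n - 1ℚ) v≡) (ι-suc-1 v₁))

  equations : Relations.Equations K W V M L Fam C₁ R₁ C₂ R₂ (a t₁) (a t₂) (a t₃) (a t₄) (a t₅) (a t₆)
                                  (a t₇) (a t₈) (a t₉) (a t₁₀) (a t₁₁) (a t₁₂) (a t₁₃)
  equations = record
    { K-1≢0 = λ eq → ι-suc≢0 j (trans (sym (ι-suc-1 (suc j))) eq)
    ; W-1≢0 = λ eq → ι≢0 w w≢0 (trans (sym (ι-suc-1 w)) eq)
    ; K≢0 = ι-suc≢0 (suc j)
    ; W≢0 = ι-suc≢0 w
    ; through-p₁ = transfer (# r₁ ⊗ #K-1) #W-1 P₁₂.blocksThrough-eq
    ; through-p₂ = transfer (# r₂ ⊗ #K-1) #W-1 P₂₁.blocksThrough-eq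
    ; blocks₁ = transfer ((# c₁ ⊕ # r₁) ⊗ (#K ⊗ #K-1)) (#W ⊗ #W-1) P₁₂.blocksOfD₁-eq
    ; blocks₂ = transfer ((# c₂ ⊕ # r₂) ⊗ (#K ⊗ #K-1)) (#W ⊗ #W-1) P₂₁.blocksOfD₁-eq
    ; avoiding₁ = transfer (#a t₁ ⊕ #a t₃ ⊕ #a t₅ ⊕ # c₁) (# m ⊗ # c₁) (trans (avoid-sum c₁ N) (sym P₁₂.avoiding-count))
    ; avoiding₂ = transfer (#a t₁ ⊕ #a t₄ ⊕ #a t₆ ⊕ # c₂) (# m ⊗ # c₂) avoiding-mirrored
    ; through₁ = transfer (#a t₂ ⊕ #a t₇ ⊕ # r₁) (# m ⊗ # r₁) (trans (through-sum r₁ N) (sym P₁₂.through-count))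
    ; through₂ = transfer (#a t₂ ⊕ #a t₈ ⊕ # r₂) (# m ⊗ # r₂) through-mirrored
    ; crossing = transfer (#K ⊗ #K ⊗ #a t₁ ⊕ #K-1 ⊗ #K-1 ⊗ #a t₂ ⊕ #K ⊗ #a t₃ ⊕ #K ⊗ #a t₄ ⊕ #a t₉) (# m ⊗ (#W-1 ⊗ #W-1))
                   (trans (crossing-sum j N) (trans (sym P₁₂.crossing-pairs) (*-comm (w ℕ.* w) m)))
    ; left₁ = transfer (#K ⊗ (#a t₁ ⊕ #a t₃ ⊕ #a t₅) ⊕ #K-1 ⊗ (#a t₂ ⊕ #a t₇) ⊕ #a t₄ ⊕ #a t₉ ⊕ #a t₁₀ ⊕ #W-1) (#W-1 ⊗ # l)
                (trans (left-sum j w N) (sym L₁₂.left-points))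
    ; left₂ = transfer (#K ⊗ (#a t₁ ⊕ #a t₄ ⊕ #a t₆) ⊕ #K-1 ⊗ (#a t₂ ⊕ #a t₈) ⊕ #a t₃ ⊕ #a t₉ ⊕ #a t₁₁ ⊕ #W-1) (#W-1 ⊗ # l)
                left-mirrored
    ; at-p = transfer (#1 ⊕ #1 ⊕ #a t₂ ⊕ #a t₇ ⊕ #a t₈ ⊕ #a t₁₂) (# l) (trans (middle-sum j N) (sym L₁₂.at-p))
    ; point = transfer (# l ⊗ #W-1) (# m ⊗ #V-1) (point-count l point-l P₁₂.p)
    ; family = transfer (#1 ⊕ #1 ⊕ (#a t₁ ⊕ #a t₂ ⊕ #a t₃ ⊕ #a t₄ ⊕ #a t₅ ⊕ #a t₆ ⊕ #a t₇ ⊕ #a t₈ ⊕ #a t₉ ⊕ #a t₁₀ ⊕ #a t₁₁ ⊕ #a t₁₂ ⊕ #a t₁₃))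
                       (# (length 𝒟)) (trans (total-sum N) (sym P₁₂.family-by-pattern))
    ; family-size = transfer (# (length 𝒟) ⊗ (#W ⊗ #W-1)) (# m ⊗ (#V ⊗ #V-1)) (family-size v≡)
    }

  conclusion : Relations.Conclusion K W V M L Fam C₁ R₁ C₂ R₂ (a t₁) (a t₂) (a t₃) (a t₄) (a t₅) (a t₆)
                                    (a t₇) (a t₈) (a t₉) (a t₁₀) (a t₁₁) (a t₁₂) (a t₁₃)
  conclusion = Relations.solution K W V M L Fam C₁ R₁ C₂ R₂ (a t₁) (a t₂) (a t₃) (a t₄) (a t₅) (a t₆)
                                  (a t₇) (a t₈) (a t₉) (a t₁₀) (a t₁₁) (a t₁₂) (a t₁₃) equations

-- Proposition 2.10. The degenerate parameters are excluded by the hypotheses (k ≥ 2 and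
-- v' > k); otherwise the statement is the solution of the counting system.
proposition2p10 :
  (v k : ℕ) (Bs : List (Subset v)) → IsBIBD v k 1 Bs →
  (𝒟 : List (Subset v)) → Unique 𝒟 →
  (∀ D → (D ∈L 𝒟) ⇔ IsMinimalSubBIBD k Bs D) →
  (m : ℕ) →
  (Σ ℕ λ l → ∀ x → pointCount 𝒟 x ≡ l) →
  (∀ B → B ∈L Bs → blockCount 𝒟 B ≡ m) →
  (v' : ℕ) → (∀ D → D ∈L 𝒟 → ∣ D ∣ ≡ v') →
  (D₁ D₂ : Subset v) → D₁ ∈L 𝒟 → D₂ ∈L 𝒟 → ∣ D₁ ∩ D₂ ∣ ≡ 1 →
  let N = Ncount 𝒟 D₁ D₂
      a1 = ι (N k 0 k)
      a2 = ι (N (k ∸ 1) 1 (k ∸ 1))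
      a3 = ι (N k 0 1)
      a4 = ι (N 1 0 k)
      a5 = ι (N k 0 0)
      a6 = ι (N 0 0 k)
      a7 = ι (N (k ∸ 1) 1 0)
      a8 = ι (N 0 1 (k ∸ 1))
      a9 = ι (N 1 0 1)
      a10 = ι (N 1 0 0)
      a11 = ι (N 0 0 1)
      a12 = ι (N 0 1 0)
      a13 = ι (N 0 0 0)
      V = ι v
      K = ι k
      W = ι v'
      M = ι m
      one = ι 1
      two = ι 2
  in (a5 ≡ (M - one) * (W - one) * (W - K) ÷' (K * (K - one)) - a1 - a3)
   × (a6 ≡ (M - one) * (W - one) * (W - K) ÷' (K * (K - one)) - a1 - a4)
   × (a7 ≡ (M - one) * (W - one) ÷' (K - one) - a2)
   × (a8 ≡ (M - one) * (W - one) ÷' (K - one) - a2)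
   × (a9 ≡ M * ((W - one) * (W - one)) - K * K * a1 - (K - one) * (K - one) * a2
            - K * a3 - K * a4)
   × (a10 ≡ M * (V - one - K * ((W - one) * (W - one)) ÷' (K - one))
             + (W - one) * (W - K) ÷' (K - one)
             + K * K * a1 + (K - one) * (K - one) * a2 + K * a3 + (K - one) * a4)
   × (a11 ≡ M * (V - one - K * ((W - one) * (W - one)) ÷' (K - one))
             + (W - one) * (W - K) ÷' (K - one)
             + K * K * a1 + (K - one) * (K - one) * a2 + (K - one) * a3 + K * a4)
   × (a12 ≡ M * ((V - one) ÷' (W - one) - two * (W - one) ÷' (K - one))
             + two * (W - K) ÷' (K - one) + a2)
   × (a13 ≡ M * (V * (V - one) ÷' (W * (W - one)) + (W - one) * (W - one)
                 + (V - one) ÷' (W - one)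
                 - two * W * ((V - one) ÷' (W - one) - (W - one) ÷' K))
             - two * (W - one) * (W - K) ÷' K
             - (K * K - one) * a1 - (K - one) * (K - one) * a2
             - (K - one) * a3 - (K - one) * a4)
proposition2p10 _ zero _ bibd _ _ _ _ _ _ _ _ _ _ _ _ _ = ⊥-elim (n≮0 (IsDesign.two≤k bibd))
proposition2p10 _ (suc zero) _ bibd _ _ _ _ _ _ _ _ _ _ _ _ _ = ⊥-elim (n≮n 1 (IsDesign.two≤k bibd))
proposition2p10 _ (suc (suc j)) _ _ _ _ 𝒟-minimal _ _ _ zero size D₁ _ D₁∈ _ _ =
  ⊥-elim (n≮0 (subst (suc (suc j) <_) (size D₁ D₁∈) (proj₁ (proj₂ (Equivalence.to (𝒟-minimal D₁) D₁∈)))))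
proposition2p10 v (suc (suc j)) Bs bibd 𝒟 𝒟-unique 𝒟-minimal m (l , point-l) block-m (suc w) size D₁ D₂ D₁∈ D₂∈ one-point =
  Assembly.conclusion v j Bs bibd 𝒟 𝒟-unique 𝒟-minimal m l point-l block-m w size D₁ D₂ D₁∈ D₂∈ one-point
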